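{- Let $b$ be a positive integer. Then the proportion of points in $\mathbb{N}\times\mathbb{N}$ that are $(-b)$-visible is $\frac{1}{\zeta(b)}$.
   Context: $\mathbb{N}=\{1,2,3,\ldots\}$ and $\zeta$ is the Riemann zeta function; for $b=1$, $\frac{1}{\zeta(1)}$ is understood as $0$ (the value of $\prod_p(1-1/p)$). A point $(r,s)\in\mathbb{N}\times\mathbb{N}$ is $(-b)$-visible (from the point at infinity $(\infty,0)$) if it lies on the graph of $f(x)=nx^{ -b}$ for some $n\in\mathbb{Q}$ and there is no other point of $\mathbb{N}\times\mathbb{N}$ on the graph of $f$ between $(r,s)$ and $(\infty,0)$ (i.e. no $(r',s')\in\mathbb{N}\times\mathbb{N}$ with $s'=f(r')$ and $r'>r$). The proportion of points of $\mathbb{N}\times\mathbb{N}$ with a property is the limit as $N\to\infty$ of the fraction of pairs $(r,s)\in\{1,\ldots,N\}\times\{1,\ldots,N\}$ with that property. -}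

module Defs where

open import Data.Nat as ℕ using (ℕ; zero; suc; _*_; _^_; _<_; _≤_)
open import Data.Nat.Properties using (m^n≢0)
open import Data.Integer using (+_)
open import Data.Rational as ℚ using (ℚ; 0ℚ; 1ℚ; _+_; _/_; 1/_; _≟_)
open import Data.Product using (_×_; _,_)
open import Data.List using (List)
open import Data.List.Membership.Propositional using (_∈_)
open import Function.Bundles using (_⇔_)
open import Relation.Binary.PropositionalEquality using (_≡_)
open import Relation.Nullary using (¬_; yes; no)

-- (r , s) ∈ ℕ×ℕ (positive coordinates) is (-b)-visible from (∞,0):
-- the unique curve f(x) = n x^{-b} through (r,s) has n = s * r^b, and
-- no point (r', s') ∈ ℕ×ℕ with r' > r lies on it, i.e. s' * r'^b ≠ s * r^b.
Visible : ℕ → ℕ → ℕ → Set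
Visible b r s = ∀ r' s' → 1 ≤ r' → 1 ≤ s' → r < r' → ¬ (s' * r' ^ b ≡ s * r ^ b)

VisibleList : ℕ → ℕ → List (ℕ × ℕ) → Set
VisibleList b N L = ∀ r s → ((r , s) ∈ L) ⇔ ((1 ≤ r × r ≤ N) × (1 ≤ s × s ≤ N) × Visible b r s)

-- fraction c / N² (N = 0 gives 0; irrelevant for the limit)
frac : ℕ → ℕ → ℚ
frac c zero = 0ℚ
frac c (suc n) = (+ c) / (suc n * suc n)

zetaPartial : ℕ → ℕ → ℚ
zetaPartial b zero = 0ℚ
zetaPartial b (suc m) = zetaPartial b m + (+ 1) / (suc m ^ b)
  where instance _ = m^n≢0 (suc m) b

-- 1 / ζ_M(b)  (ζ_M(b) ≥ 1 for M ≥ 1; the 0 branch only occurs for M = 0)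
invZetaPartial : ℕ → ℕ → ℚ
invZetaPartial b M with zetaPartial b M ≟ 0ℚ
... | yes _ = 0ℚ
... | no p = 1/_ (zetaPartial b M) {{ℚ.≢-nonZero p}}

module Submission where

-- A point (r, s) is visible iff s is b-th-power-free (no d^b with d ≥ 2 divides
-- s): a farther point (r', s') on the curve y = n x^{-b} satisfies
-- s' r'^b = s r^b, and splitting r' = g a, r = g c with a ⊥ c forces a^b ∣ s.
-- Hence the visible points of [1, N]² form the grid [1, N] × {power-free s ≤ N},
-- and their proportion is Q(N)/N with Q(N) the number of power-free s ≤ N.
--
-- Every n ≥ 1 is uniquely d^b m with m power-free, so Σ_d Q(⌊N/d^b⌋) = N.
-- Writing E(n) = ζ_M(b) Q(n) − n, this identity shows that E(N) is a small
-- main term minus Σ_{d ≥ 2} E(⌊N/d^b⌋); since ζ(b) − 1 ≤ 3/4 for b ≥ 2, a bound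
-- |E(n)| ≤ β n for large n improves to |E(N)| ≤ (3/T + 3β/4) N, and iterating
-- makes E(N)/N as small as we like, uniformly in M.  For b = 1 only s = 1 is
-- power-free and the harmonic numbers diverge, so both sides tend to 0.

module PowerFree where

  open import Data.Nat
  open import Data.Nat.Properties
  open import Data.Nat.Divisibility
  open import Data.Nat.DivMod using (_/_; m*n/n≡m)
  open import Data.Nat.Coprimality as Coprime using (Coprime; coprime-divisor)
  open import Data.Nat.GCD using (gcd; gcd[m,n]∣m; gcd[m,n]∣n; gcd[m,n]≢0)
  open import Data.Empty using (⊥; ⊥-elim)
  open import Data.Product using (Σ; _×_; _,_)
  open import Data.Sum using (_⊎_; inj₁; inj₂)
  open import Data.Nat.Induction using (<-rec)
  open import Relation.Nullary using (Dec; yes; no; _×-dec_)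
  open import Relation.Binary.PropositionalEquality
  open import Data.Nat.Solver using (module +-*-Solver)
  open +-*-Solver using (solve; _:*_; _:=_)
  open import Defs using (Visible)

  PowerFree : ℕ → ℕ → Set
  PowerFree b s = ∀ d → 2 ≤ d → d ^ b ∣ s → ⊥

  ^-distribʳ-* : ∀ m n b → (m * n) ^ b ≡ m ^ b * n ^ b
  ^-distribʳ-* m n zero = refl
  ^-distribʳ-* m n (suc b) rewrite ^-distribʳ-* m n b =
    solve 4 (λ m n x y → (m :* n) :* (x :* y) := (m :* x) :* (n :* y)) refl m n (m ^ b) (n ^ b)

  *-posˡ : ∀ {m n} → 1 ≤ m * n → 1 ≤ m
  *-posˡ {m} 1≤mn = >-nonZero⁻¹ m {{m*n≢0⇒m≢0 m {{>-nonZero 1≤mn}}}}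

  *-posʳ : ∀ m {n} → 1 ≤ m * n → 1 ≤ n
  *-posʳ m {n} 1≤mn = >-nonZero⁻¹ n {{m*n≢0⇒n≢0 m {{>-nonZero 1≤mn}}}}

  1≤^ : ∀ d b → 1 ≤ d → 1 ≤ d ^ b
  1≤^ d b 1≤d = m^n>0 d {{>-nonZero 1≤d}} b

  ≤-^ : ∀ d b → 1 ≤ d → 1 ≤ b → d ≤ d ^ b
  ≤-^ (suc d) (suc b) _ _ = m≤m*n (suc d) (suc d ^ b) {{m^n≢0 (suc d) b}}

  coprime-*ʳ : ∀ {m n o} → Coprime m n → Coprime m o → Coprime m (n * o)
  coprime-*ʳ {m} {n} {o} m⊥n m⊥o {d} (d∣m , d∣no) =
    m⊥o (d∣m , coprime-divisor {d} {n} {o} (λ {e} (e∣d , e∣n) → m⊥n (∣-trans e∣d d∣m , e∣n)) d∣no)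

  coprime-^ʳ : ∀ {m n} b → Coprime m n → Coprime m (n ^ b)
  coprime-^ʳ zero    _   (_ , d∣1) = ∣1⇒≡1 d∣1
  coprime-^ʳ (suc b) m⊥n = coprime-*ʳ m⊥n (coprime-^ʳ b m⊥n)

  coprime-^ : ∀ {m n} b → Coprime m n → Coprime (m ^ b) (n ^ b)
  coprime-^ b m⊥n = Coprime.sym (coprime-^ʳ b (Coprime.sym (coprime-^ʳ b m⊥n)))

  coprime-power-trivial : ∀ b {a c x y} → Coprime a c → a ^ b * x ≡ c ^ b * y →
    PowerFree b y → 1 ≤ a → a ≡ 1
  coprime-power-trivial b {1}           a⊥c eq y-free _ = refl
  coprime-power-trivial b {suc (suc a)} {x = x} a⊥c eq y-free _ =
    ⊥-elim (y-free (suc (suc a)) (s≤s (s≤s z≤n))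
      (coprime-divisor (coprime-^ b a⊥c) (divides x (trans (sym eq) (*-comm _ x)))))

  gcd-split : ∀ d d' → 1 ≤ d → Σ ℕ λ g → Σ ℕ λ a → Σ ℕ λ a' →
    d ≡ g * a × d' ≡ g * a' × Coprime a a' × 1 ≤ g
  gcd-split d d' 1≤d with gcd[m,n]∣m d d' | gcd[m,n]∣n d d'
  ... | divides a d≡ag | divides a' d'≡a'g =
    gcd d d' , a , a' , trans d≡ag (*-comm a _) , trans d'≡a'g (*-comm a' _) ,
    subst₂ Coprime (cofactor d≡ag) (cofactor d'≡a'g) (Coprime.coprime-/gcd d d') , n≢0⇒n>0 g≢0
    where
      g≢0 = gcd[m,n]≢0 d d' (inj₁ (n>0⇒n≢0 1≤d))
      instance _ = ≢-nonZero g≢0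
      cofactor : ∀ {e q} → e ≡ q * gcd d d' → e / gcd d d' ≡ q
      cofactor {q = q} refl = m*n/n≡m q (gcd d d')

  cancel-common-power : ∀ b g a c x y → 1 ≤ g →
    (g * a) ^ b * x ≡ (g * c) ^ b * y → a ^ b * x ≡ c ^ b * y
  cancel-common-power b g a c x y 1≤g eq =
    *-cancelˡ-≡ (a ^ b * x) (c ^ b * y) (g ^ b) {{m^n≢0 g b {{>-nonZero 1≤g}}}} (begin
      g ^ b * (a ^ b * x) ≡⟨ sym (*-assoc (g ^ b) _ x) ⟩
      g ^ b * a ^ b * x   ≡⟨ cong (_* x) (sym (^-distribʳ-* g a b)) ⟩
      (g * a) ^ b * x     ≡⟨ eq ⟩
      (g * c) ^ b * y     ≡⟨ cong (_* y) (^-distribʳ-* g c b) ⟩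
      g ^ b * c ^ b * y   ≡⟨ *-assoc (g ^ b) _ y ⟩
      g ^ b * (c ^ b * y) ∎)
    where open ≡-Reasoning

  -- A power-free s makes (r , s) visible: a farther point on the same curve
  -- would give s' (ga)^b = s (gc)^b with a ⊥ c, hence a = 1 and r' ≤ r.
  powerFree⇒visible : ∀ b r s → 1 ≤ r → PowerFree b s → Visible b r s
  powerFree⇒visible b r s 1≤r s-free r' s' 1≤r' _ r<r' eq
    with gcd-split r' r 1≤r'
  ... | g , a , c , refl , refl , a⊥c , 1≤g = <-irrefl refl (<-≤-trans r<r' r'≤r)
    where
      eq′ : (g * a) ^ b * s' ≡ (g * c) ^ b * s
      eq′ = trans (*-comm _ s') (trans eq (*-comm s _))
      a≡1 : a ≡ 1
      a≡1 = coprime-power-trivial b a⊥c (cancel-common-power b g a c s' s 1≤g eq′) s-free (*-posʳ g 1≤r')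
      r'≤r : g * a ≤ g * c
      r'≤r rewrite a≡1 = *-monoʳ-≤ g (*-posʳ g 1≤r)

  -- Conversely, if d^b ∣ s with d ≥ 2 then (d r , s / d^b) lies farther out on the curve.
  visible⇒powerFree : ∀ b r s → 1 ≤ r → 1 ≤ s → Visible b r s → PowerFree b s
  visible⇒powerFree b r s 1≤r 1≤s visible d 2≤d (divides q refl) =
    visible (d * r) q (*-mono-≤ (≤-trans (s≤s z≤n) 2≤d) 1≤r) (*-posˡ 1≤s) r<dr eq
    where
      r<dr : r < d * r
      r<dr = subst (_< d * r) (*-identityˡ r) (*-monoˡ-< r {{>-nonZero 1≤r}} 2≤d)
      eq : q * (d * r) ^ b ≡ q * d ^ b * r ^ b
      eq rewrite ^-distribʳ-* d r b = sym (*-assoc q (d ^ b) (r ^ b))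

  -- Either s is power-free or we exhibit a witness d ≥ 2 with d^b ∣ s (such a d
  -- is at most s, so a bounded search suffices).
  powerFree-or-witness : ∀ b s → 1 ≤ b → 1 ≤ s →
    PowerFree b s ⊎ (Σ ℕ λ d → 2 ≤ d × d ^ b ∣ s)
  powerFree-or-witness b s 1≤b 1≤s
    with anyUpTo? (λ d → 2 ≤? d ×-dec d ^ b ∣? s) (suc s)
  ... | yes (d , _ , witness) = inj₂ (d , witness)
  ... | no none = inj₁ λ d 2≤d d^b∣s → none (d , s≤s (d≤s d 2≤d d^b∣s) , 2≤d , d^b∣s)
    where
      d≤s : ∀ d → 2 ≤ d → d ^ b ∣ s → d ≤ s
      d≤s d 2≤d d^b∣s = ≤-trans (≤-^ d b (≤-trans (s≤s z≤n) 2≤d) 1≤b) (∣⇒≤ {{>-nonZero 1≤s}} d^b∣s)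

  -- Power-freeness is decidable (b = 0 and s = 0 never are: 2^0 ∣ s, 2^b ∣ 0).
  powerFree? : ∀ b s → Dec (PowerFree b s)
  powerFree? zero    s       = no λ s-free → s-free 2 ≤-refl (1∣ s)
  powerFree? (suc b) zero    = no λ s-free → s-free 2 ≤-refl (_ ∣0)
  powerFree? (suc b) (suc s) with powerFree-or-witness (suc b) (suc s) (s≤s z≤n) (s≤s z≤n)
  ... | inj₁ s-free              = yes s-free
  ... | inj₂ (d , 2≤d , d^b∣s) = no λ s-free → s-free d 2≤d d^b∣s

  PowerPart : ℕ → ℕ → ℕ → Set
  PowerPart b n d = 1 ≤ d × Σ ℕ λ m → n ≡ d ^ b * m × PowerFree b m

  -- Every n ≥ 1 has a b-th-power part (strip b-th powers while possible).
  powerPart-exists : ∀ b → 1 ≤ b → ∀ n → 1 ≤ n → Σ ℕ (PowerPart b n)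
  powerPart-exists b 1≤b = <-rec (λ n → 1 ≤ n → Σ ℕ (PowerPart b n)) step
    where
      step : ∀ n → (∀ {q} → q < n → 1 ≤ q → Σ ℕ (PowerPart b q)) → 1 ≤ n → Σ ℕ (PowerPart b n)
      step n rec 1≤n with powerFree-or-witness b n 1≤b 1≤n
      ... | inj₁ n-free = 1 , ≤-refl , n , sym (trans (cong (_* n) (^-zeroˡ b)) (*-identityˡ n)) , n-free
      ... | inj₂ (e , 2≤e , divides q refl) with rec q<n 1≤q
        where
          1≤q : 1 ≤ q
          1≤q = *-posˡ 1≤n
          q<n : q < q * e ^ b
          q<n = subst (_< q * e ^ b) (*-identityʳ q)
                  (*-monoʳ-< q {{>-nonZero 1≤q}} (<-≤-trans 2≤e (≤-^ e b (≤-trans (s≤s z≤n) 2≤e) 1≤b)))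
      ... | d , 1≤d , m , refl , m-free = e * d , *-mono-≤ (≤-trans (s≤s z≤n) 2≤e) 1≤d , m , eq , m-free
        where
          eq : d ^ b * m * e ^ b ≡ (e * d) ^ b * m
          eq rewrite ^-distribʳ-* e d b =
            solve 3 (λ x y z → x :* z :* y := y :* x :* z) refl (d ^ b) (e ^ b) m

  -- The b-th-power part is unique: d^b m = d'^b m' (m, m' power-free) forces
  -- d = d', again by the gcd argument.
  powerPart-unique : ∀ b {n d d'} → PowerPart b n d → PowerPart b n d' → d ≡ d'
  powerPart-unique b {d = d} {d'} (1≤d , m , refl , m-free) (1≤d' , m' , eq , m'-free)
    with gcd-split d d' 1≤d
  ... | g , a , a' , refl , refl , a⊥a' , 1≤g = cong (g *_) (trans a≡1 (sym a'≡1))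
    where
      eq′ : a ^ b * m ≡ a' ^ b * m'
      eq′ = cancel-common-power b g a a' m m' 1≤g eq
      a≡1 : a ≡ 1
      a≡1 = coprime-power-trivial b a⊥a' eq′ m'-free (*-posʳ g 1≤d)
      a'≡1 : a' ≡ 1
      a'≡1 = coprime-power-trivial b (Coprime.sym a⊥a') (sym eq′) m-free (*-posʳ g 1≤d')

module Counting where

  open import Data.Nat
  open import Data.Nat.Properties
  open import Data.Nat.Divisibility using (_∣_; divides; _∣?_)
  open import Data.Nat.DivMod
    using (_/_; _%_; m≡m%n+[m/n]*n; m%n<n; m/n*n≤m; m*n/n≡m; /-monoˡ-≤; m<n*o⇒m/o<n; n/1≡n)
  open import Data.List using (List; map; downFrom; filter; length)
  open import Data.List.Properties using (length-filter; length-map; length-downFrom)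
  open import Data.Empty using (⊥-elim)
  open import Data.Product using (_×_; _,_; proj₁; proj₂)
  open import Relation.Nullary using (¬_; Dec; yes; no)
  open import Data.Sum using (inj₁; inj₂)
  open import Relation.Binary.PropositionalEquality
  open import Algebra.Properties.CommutativeSemigroup +-commutativeSemigroup
    using () renaming (interchange to +-interchange)
  open PowerFree

  𝟙 : ∀ {p} {P : Set p} → Dec P → ℕ
  𝟙 (yes _) = 1
  𝟙 (no _)  = 0

  𝟙-yes : ∀ {p} {P : Set p} (P? : Dec P) → P → 𝟙 P? ≡ 1
  𝟙-yes (yes _) _ = refl
  𝟙-yes (no ¬p) p = ⊥-elim (¬p p)

  𝟙-no : ∀ {p} {P : Set p} (P? : Dec P) → ¬ P → 𝟙 P? ≡ 0
  𝟙-no (yes p) ¬p = ⊥-elim (¬p p)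
  𝟙-no (no _)  _  = refl

  𝟙-cong : ∀ {p q} {P : Set p} {R : Set q} (P? : Dec P) (R? : Dec R) → (P → R) → (R → P) → 𝟙 P? ≡ 𝟙 R?
  𝟙-cong (yes p) R? to _    = sym (𝟙-yes R? (to p))
  𝟙-cong (no ¬p) R? _  from = sym (𝟙-no R? (λ r → ¬p (from r)))

  sumℕ : (ℕ → ℕ) → ℕ → ℕ
  sumℕ f zero    = 0
  sumℕ f (suc n) = sumℕ f n + f (suc n)

  sumℕ-cong : ∀ {f g} n → (∀ d → 1 ≤ d → f d ≡ g d) → sumℕ f n ≡ sumℕ g n
  sumℕ-cong zero    _   = refl
  sumℕ-cong (suc n) f≡g = cong₂ _+_ (sumℕ-cong n f≡g) (f≡g (suc n) (s≤s z≤n))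

  sumℕ-+ : ∀ f g n → sumℕ (λ d → f d + g d) n ≡ sumℕ f n + sumℕ g n
  sumℕ-+ f g zero    = refl
  sumℕ-+ f g (suc n) rewrite sumℕ-+ f g n = +-interchange (sumℕ f n) (sumℕ g n) (f (suc n)) (g (suc n))

  sumℕ-zero : ∀ f n → (∀ d → 1 ≤ d → d ≤ n → f d ≡ 0) → sumℕ f n ≡ 0
  sumℕ-zero f zero    _  = refl
  sumℕ-zero f (suc n) f≡0
    rewrite sumℕ-zero f n (λ d 1≤d d≤n → f≡0 d 1≤d (m≤n⇒m≤1+n d≤n)) | f≡0 (suc n) (s≤s z≤n) ≤-refl = refl

  count-unique : ∀ {P : ℕ → Set} (P? : ∀ d → Dec (P d)) {w} → (∀ d → P d → d ≡ w) → P w →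
    ∀ B → 1 ≤ w → w ≤ B → sumℕ (λ d → 𝟙 (P? d)) B ≡ 1
  count-unique P? {w} only-w Pw (suc B) 1≤w w≤B with m≤n⇒m<n∨m≡n w≤B
  ... | inj₁ (s≤s w≤B') =
    cong₂ _+_ (count-unique P? only-w Pw B 1≤w w≤B') (𝟙-no (P? (suc B)) λ p → <-irrefl (sym (only-w _ p)) (s≤s w≤B'))
  ... | inj₂ refl =
    cong₂ _+_ (sumℕ-zero _ B λ d _ d≤B → 𝟙-no (P? d) λ p → <-irrefl (only-w d p) (s≤s d≤B)) (𝟙-yes (P? w) Pw)
  count-unique P? only-w Pw zero (s≤s _) ()

  -- Floor division, extended by n div₀ 0 = 0 so that it can be summed over all d.
  infixl 7 _div₀_
  _div₀_ : ℕ → ℕ → ℕ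
  n div₀ zero  = 0
  n div₀ suc k = n / suc k

  div₀-floor : ∀ n k → n div₀ k * k ≤ n
  div₀-floor n zero    = z≤n
  div₀-floor n (suc k) = m/n*n≤m n (suc k)

  div₀-ceil : ∀ n k → 1 ≤ k → n < suc (n div₀ k) * k
  div₀-ceil n (suc k) _ = begin-strict
    n                              ≡⟨ m≡m%n+[m/n]*n n (suc k) ⟩
    n % suc k + n / suc k * suc k  <⟨ +-monoˡ-< (n / suc k * suc k) (m%n<n n (suc k)) ⟩
    suc k + n / suc k * suc k      ∎
    where open ≤-Reasoning

  div₀-unique : ∀ {n k q} → 1 ≤ k → q * k ≤ n → n < suc q * k → n div₀ k ≡ q
  div₀-unique {n} {suc k} {q} _ lo hi =
    ≤-antisym (≤-pred (m<n*o⇒m/o<n hi)) (subst (_≤ n / suc k) (m*n/n≡m q (suc k)) (/-monoˡ-≤ (suc k) lo))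

  div₀-≥ : ∀ {n k K} → 1 ≤ k → k * K ≤ n → K ≤ n div₀ k
  div₀-≥ {n} {suc k} {K} _ kK≤n =
    subst (_≤ n / suc k) (m*n/n≡m K (suc k)) (/-monoˡ-≤ (suc k) (subst (_≤ n) (*-comm (suc k) K) kK≤n))

  div₀-1 : ∀ n → n div₀ 1 ≡ n
  div₀-1 = n/1≡n

  div₀-0 : ∀ k → 0 div₀ k ≡ 0
  div₀-0 zero    = refl
  div₀-0 (suc k) = refl

  div₀-suc-∤ : ∀ n {k} → 1 ≤ k → ¬ k ∣ suc n → suc n div₀ k ≡ n div₀ k
  div₀-suc-∤ n {k} 1≤k k∤ = div₀-unique 1≤k (≤-trans (div₀-floor n k) (n≤1+n n)) hi
    where
      hi : suc n < suc (n div₀ k) * k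
      hi with m≤n⇒m<n∨m≡n (div₀-ceil n k 1≤k)
      ... | inj₁ lt = lt
      ... | inj₂ eq = ⊥-elim (k∤ (divides (suc (n div₀ k)) eq))

  div₀-suc-∣ : ∀ n {k p} → 1 ≤ k → suc n ≡ suc p * k → n div₀ k ≡ p × suc n div₀ k ≡ suc p
  div₀-suc-∣ n {suc k} {p} _ eq =
    div₀-unique (s≤s z≤n) (≤-pred (subst (p * suc k <_) (sym eq) (m<n+m (p * suc k) (s≤s z≤n)))) (≤-reflexive eq) ,
    div₀-unique (s≤s z≤n) (≤-reflexive (sym eq)) (subst (_< suc (suc p) * suc k) (sym eq) (m<n+m (suc p * suc k) (s≤s z≤n)))

  range : ℕ → List ℕ
  range n = map suc (downFrom n)

  powerFreeUpTo : ℕ → ℕ → List ℕ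
  powerFreeUpTo b n = filter (powerFree? b) (range n)

  Q : ℕ → ℕ → ℕ
  Q b n = length (powerFreeUpTo b n)

  Q-suc : ∀ b n → Q b (suc n) ≡ Q b n + 𝟙 (powerFree? b (suc n))
  Q-suc b n with powerFree? b (suc n)
  ... | yes _ = +-comm 1 (Q b n)
  ... | no _  = sym (+-identityʳ (Q b n))

  Q≤ : ∀ b n → Q b n ≤ n
  Q≤ b n = ≤-trans (length-filter (powerFree? b) (range n))
             (≤-reflexive (trans (length-map suc (downFrom n)) (length-downFrom n)))

  powerPart? : ∀ b n d → Dec (PowerPart b n d)
  powerPart? b n zero = no λ ()
  powerPart? b n (suc d) with suc d ^ b ∣? n
  ... | no ∤n = no λ (_ , m , eq , _) → ∤n (divides m (trans eq (*-comm _ m)))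
  ... | yes (divides q eq) with powerFree? b q
  ...   | yes q-free = yes (s≤s z≤n , q , trans eq (*-comm q _) , q-free)
  ...   | no ¬q-free = no λ (_ , m , eq′ , m-free) → ¬q-free (subst (PowerFree b) (m≡q eq′) m-free)
    where
      m≡q : ∀ {m} → n ≡ suc d ^ b * m → m ≡ q
      m≡q {m} eq′ = *-cancelˡ-≡ m q (suc d ^ b) {{m^n≢0 (suc d) b}} (trans (sym eq′) (trans eq (*-comm q _)))

  -- Q(⌊N / d^b⌋) grows by one, as N steps to N + 1, exactly when d^b is the
  -- power part of N + 1 (then (N + 1) / d^b is a new power-free number).
  Q-step : ∀ b N d → 1 ≤ d →
    Q b (suc N div₀ d ^ b) ≡ Q b (N div₀ d ^ b) + 𝟙 (powerPart? b (suc N) d)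
  Q-step b N d 1≤d with d ^ b ∣? suc N
  ... | no k∤ = begin
    Q b (suc N div₀ d ^ b)     ≡⟨ cong (Q b) (div₀-suc-∤ N (1≤^ d b 1≤d) k∤) ⟩
    Q b (N div₀ d ^ b)         ≡⟨ sym (+-identityʳ _) ⟩
    Q b (N div₀ d ^ b) + 0     ≡⟨ cong (Q b (N div₀ d ^ b) +_) (sym (𝟙-no (powerPart? b (suc N) d) not-part)) ⟩
    Q b (N div₀ d ^ b) + 𝟙 (powerPart? b (suc N) d) ∎
    where
      open ≡-Reasoning
      not-part : ¬ PowerPart b (suc N) d
      not-part (_ , m , eq , _) = k∤ (divides m (trans eq (*-comm _ m)))
  ... | yes (divides zero ())
  ... | yes (divides (suc p) eq) = begin
    Q b (suc N div₀ d ^ b)                   ≡⟨ cong (Q b) quotient-suc ⟩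
    Q b (suc p)                              ≡⟨ Q-suc b p ⟩
    Q b p + 𝟙 (powerFree? b (suc p))         ≡⟨ cong₂ _+_ (cong (Q b) (sym quotient))
                                                 (𝟙-cong (powerFree? b (suc p)) (powerPart? b (suc N) d) to from) ⟩
    Q b (N div₀ d ^ b) + 𝟙 (powerPart? b (suc N) d) ∎
    where
      open ≡-Reasoning
      quotient : N div₀ d ^ b ≡ p
      quotient = proj₁ (div₀-suc-∣ N (1≤^ d b 1≤d) eq)
      quotient-suc : suc N div₀ d ^ b ≡ suc p
      quotient-suc = proj₂ (div₀-suc-∣ N (1≤^ d b 1≤d) eq)
      eq′ : suc N ≡ d ^ b * suc p
      eq′ = trans eq (*-comm (suc p) _)
      to : PowerFree b (suc p) → PowerPart b (suc N) d
      to free = 1≤d , suc p , eq′ , free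
      from : PowerPart b (suc N) d → PowerFree b (suc p)
      from (_ , m , eqm , free) =
        subst (PowerFree b) (*-cancelˡ-≡ m (suc p) (d ^ b) {{>-nonZero (1≤^ d b 1≤d)}} (trans (sym eqm) eq′)) free

  powerPart-count : ∀ b → 1 ≤ b → ∀ n B → 1 ≤ n → n ≤ B → sumℕ (λ d → 𝟙 (powerPart? b n d)) B ≡ 1
  powerPart-count b 1≤b n B 1≤n n≤B with powerPart-exists b 1≤b n 1≤n
  ... | w , part@(1≤w , m , eq , _) =
    count-unique (powerPart? b n) (λ d part′ → powerPart-unique b part′ part) part B 1≤w w≤B
    where
      1≤m : 1 ≤ m
      1≤m = *-posʳ (w ^ b) (subst (1 ≤_) eq 1≤n)
      w≤B : w ≤ B
      w≤B = ≤-trans (≤-^ w b 1≤w 1≤b)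
              (≤-trans (m≤m*n (w ^ b) m {{>-nonZero 1≤m}}) (≤-trans (≤-reflexive (sym eq)) n≤B))

  -- Σ_{d=1}^{B} Q(⌊N / d^b⌋) = N for B ≥ N: each n ≤ N is counted once, as d^b m.
  counting-identity : ∀ b → 1 ≤ b → ∀ B N → N ≤ B → sumℕ (λ d → Q b (N div₀ d ^ b)) B ≡ N
  counting-identity b 1≤b B zero    _     = sumℕ-zero _ B λ d _ _ → cong (Q b) (div₀-0 (d ^ b))
  counting-identity b 1≤b B (suc N) 1+N≤B = begin
    sumℕ (λ d → Q b (suc N div₀ d ^ b)) B
      ≡⟨ sumℕ-cong B (Q-step b N) ⟩
    sumℕ (λ d → Q b (N div₀ d ^ b) + 𝟙 (powerPart? b (suc N) d)) B
      ≡⟨ sumℕ-+ _ _ B ⟩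
    sumℕ (λ d → Q b (N div₀ d ^ b)) B + sumℕ (λ d → 𝟙 (powerPart? b (suc N) d)) B
      ≡⟨ cong₂ _+_ (counting-identity b 1≤b B N (≤-trans (n≤1+n N) 1+N≤B))
                   (powerPart-count b 1≤b (suc N) B (s≤s z≤n) 1+N≤B) ⟩
    N + 1
      ≡⟨ +-comm N 1 ⟩
    suc N ∎
    where open ≡-Reasoning

-- The visible points of [1, N]² form the grid [1, N] × {power-free s ≤ N}, so
-- any duplicate-free enumeration of them has length N · Q(N).
module VisibleGrid where

  open import Data.Nat
  open import Data.Nat.Properties
  open import Data.Product using (_×_; _,_)
  open import Data.List using (List; []; _∷_; _++_; map; downFrom; length; cartesianProduct)
  open import Data.List.Properties using (length-++; length-map; length-downFrom)
  open import Data.List.Membership.Propositional using (_∈_)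
  open import Data.List.Membership.Propositional.Properties
    using (∈-map⁺; ∈-map⁻; ∈-downFrom⁺; ∈-downFrom⁻; ∈-filter⁺; ∈-filter⁻; ∈-cartesianProduct⁺; ∈-cartesianProduct⁻)
  open import Data.List.Membership.Propositional.Properties.WithK using (unique∧set⇒bag)
  open import Data.List.Relation.Unary.Unique.Propositional using (Unique)
  import Data.List.Relation.Unary.Unique.Propositional.Properties as Unique
  open import Data.List.Relation.Binary.BagAndSetEquality using (∼bag⇒↭)
  open import Data.List.Relation.Binary.Permutation.Propositional.Properties using (↭-length)
  open import Function.Bundles using (_⇔_; mk⇔; Equivalence)
  open import Relation.Binary.PropositionalEquality
  open import Defs using (Visible; VisibleList)
  open PowerFree
  open Counting

  length-cartesianProduct : ∀ {A B : Set} (xs : List A) (ys : List B) →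
    length (cartesianProduct xs ys) ≡ length xs * length ys
  length-cartesianProduct []       ys = refl
  length-cartesianProduct (x ∷ xs) ys = begin
    length (map (x ,_) ys ++ cartesianProduct xs ys)          ≡⟨ length-++ (map (x ,_) ys) ⟩
    length (map (x ,_) ys) + length (cartesianProduct xs ys)  ≡⟨ cong₂ _+_ (length-map (x ,_) ys) (length-cartesianProduct xs ys) ⟩
    length ys + length xs * length ys                         ∎
    where open ≡-Reasoning

  ∈-range⁺ : ∀ {n r} → 1 ≤ r → r ≤ n → r ∈ range n
  ∈-range⁺ {r = suc r} _ r<n = ∈-map⁺ suc (∈-downFrom⁺ r<n)

  ∈-range⁻ : ∀ {n r} → r ∈ range n → 1 ≤ r × r ≤ n
  ∈-range⁻ r∈ with ∈-map⁻ suc r∈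
  ... | i , i∈ , refl = s≤s z≤n , ∈-downFrom⁻ i∈

  range-unique : ∀ n → Unique (range n)
  range-unique n = Unique.map⁺ suc-injective (Unique.downFrom⁺ n)

  length-range : ∀ n → length (range n) ≡ n
  length-range n = trans (length-map suc (downFrom n)) (length-downFrom n)

  grid : ℕ → ℕ → List (ℕ × ℕ)
  grid b N = cartesianProduct (range N) (powerFreeUpTo b N)

  grid-unique : ∀ b N → Unique (grid b N)
  grid-unique b N = Unique.cartesianProduct⁺ (range-unique N) (Unique.filter⁺ (powerFree? b) (range-unique N))

  ∈-grid⇔visible : ∀ b N r s →
    ((r , s) ∈ grid b N) ⇔ ((1 ≤ r × r ≤ N) × (1 ≤ s × s ≤ N) × Visible b r s)
  ∈-grid⇔visible b N r s = mk⇔ to from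
    where
      to : (r , s) ∈ grid b N → (1 ≤ r × r ≤ N) × (1 ≤ s × s ≤ N) × Visible b r s
      to rs∈ with ∈-cartesianProduct⁻ (range N) (powerFreeUpTo b N) rs∈
      ... | r∈ , s∈ with ∈-range⁻ r∈ | ∈-filter⁻ (powerFree? b) s∈
      ... | r-range@(1≤r , _) | s∈range , s-free =
        r-range , ∈-range⁻ s∈range , powerFree⇒visible b r s 1≤r s-free
      from : (1 ≤ r × r ≤ N) × (1 ≤ s × s ≤ N) × Visible b r s → (r , s) ∈ grid b N
      from ((1≤r , r≤N) , (1≤s , s≤N) , visible) =
        ∈-cartesianProduct⁺ (∈-range⁺ 1≤r r≤N)
          (∈-filter⁺ (powerFree? b) (∈-range⁺ 1≤s s≤N) (visible⇒powerFree b r s 1≤r 1≤s visible))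

  -- Any duplicate-free list L of the visible points of [1, N]² has the same
  -- members as the duplicate-free grid, so it is a permutation of it.
  visible-count : ∀ b N (L : List (ℕ × ℕ)) → Unique L → VisibleList b N L →
    length L ≡ N * Q b N
  visible-count b N L L-unique L-visible = begin
    length L                  ≡⟨ ↭-length (∼bag⇒↭ (unique∧set⇒bag L-unique (grid-unique b N) same-members)) ⟩
    length (grid b N)         ≡⟨ length-cartesianProduct (range N) (powerFreeUpTo b N) ⟩
    length (range N) * Q b N  ≡⟨ cong (_* Q b N) (length-range N) ⟩
    N * Q b N                 ∎
    where
      open ≡-Reasoning
      same-members : ∀ {x} → (x ∈ L) ⇔ (x ∈ grid b N)
      same-members {r , s} = mk⇔
        (λ x∈L → Equivalence.from (∈-grid⇔visible b N r s) (Equivalence.to (L-visible r s) x∈L))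
        (λ x∈grid → Equivalence.from (L-visible r s) (Equivalence.to (∈-grid⇔visible b N r s) x∈grid))

-- The embedding ι : ℕ → ℚ, by iterated addition of 1 (so it is visibly additive),
-- and its compatibility with fractions c / d.
module NaturalEmbedding where

  open import Data.Nat as ℕ using (ℕ; zero; suc)
  import Data.Nat.Properties as ℕP
  open import Data.Integer as ℤ using (+_)
  import Data.Integer.Properties as ℤP
  open import Data.Rational using (ℚ; 0ℚ; 1ℚ; _+_; _*_; _/_; _≤_; _<_; toℚᵘ; *≤*; *<*)
  open import Data.Rational.Properties
  import Data.Rational.Unnormalised as ℚᵘ
  import Data.Rational.Unnormalised.Properties as ℚᵘ
  open import Data.Product using (_,_)
  open import Relation.Binary.PropositionalEquality
  open import Data.Integer.Solver using (module +-*-Solver)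
  open +-*-Solver

  0≤1 : 0ℚ ≤ 1ℚ
  0≤1 = *≤* (ℤ.+≤+ ℕ.z≤n)

  0<1 : 0ℚ < 1ℚ
  0<1 = *<* (ℤ.+<+ (ℕ.s≤s ℕ.z≤n))

  ι : ℕ → ℚ
  ι zero    = 0ℚ
  ι (suc n) = 1ℚ + ι n

  ι-+ : ∀ m n → ι (m ℕ.+ n) ≡ ι m + ι n
  ι-+ zero    n = sym (+-identityˡ (ι n))
  ι-+ (suc m) n rewrite ι-+ m n = sym (+-assoc 1ℚ (ι m) (ι n))

  ι-* : ∀ m n → ι (m ℕ.* n) ≡ ι m * ι n
  ι-* zero    n = sym (*-zeroˡ (ι n))
  ι-* (suc m) n rewrite ι-+ n (m ℕ.* n) | ι-* m n =
    sym (trans (*-distribʳ-+ (ι n) 1ℚ (ι m)) (cong (_+ ι m * ι n) (*-identityˡ (ι n))))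

  ι-1 : ι 1 ≡ 1ℚ
  ι-1 = +-identityʳ 1ℚ

  0≤ι : ∀ n → 0ℚ ≤ ι n
  0≤ι zero    = ≤-refl
  0≤ι (suc n) = subst (_≤ 1ℚ + ι n) (+-identityˡ 0ℚ) (+-mono-≤ 0≤1 (0≤ι n))

  0<ι : ∀ n → 1 ℕ.≤ n → 0ℚ < ι n
  0<ι (suc n) _ = <-≤-trans 0<1 (subst (_≤ 1ℚ + ι n) (+-identityʳ 1ℚ) (+-monoʳ-≤ 1ℚ (0≤ι n)))

  ι-mono : ∀ {m n} → m ℕ.≤ n → ι m ≤ ι n
  ι-mono {m} m≤n with ℕP.m≤n⇒∃[o]m+o≡n m≤n
  ... | k , refl = subst₂ _≤_ (+-identityʳ (ι m)) (sym (ι-+ m k)) (+-monoʳ-≤ (ι m) (0≤ι k))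

  ι≃ : ∀ n → toℚᵘ (ι n) ℚᵘ.≃ ℚᵘ.mkℚᵘ (+ n) 0
  ι≃ zero    = ℚᵘ.≃-refl
  ι≃ (suc n) = ℚᵘ.≃-trans (toℚᵘ-homo-+ 1ℚ (ι n)) (ℚᵘ.≃-trans (ℚᵘ.+-congʳ (ℚᵘ.mkℚᵘ (+ 1) 0) (ι≃ n))
                 (ℚᵘ.*≡* (solve 1 (λ x → (con (+ 1) :* con (+ 1) :+ x :* con (+ 1)) :* con (+ 1)
                                     := (con (+ 1) :+ x) :* (con (+ 1) :* con (+ 1))) refl (+ n))))

  fraction-*-denominator : ∀ c d .{{_ : ℕ.NonZero d}} → (+ c) / d * ι d ≡ ι c
  fraction-*-denominator c (suc d) = toℚᵘ-injective
    (ℚᵘ.≃-trans (toℚᵘ-homo-* ((+ c) / suc d) (ι (suc d)))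
    (ℚᵘ.≃-trans (ℚᵘ.*-cong (toℚᵘ-fromℚᵘ (ℚᵘ.mkℚᵘ (+ c) d)) (ι≃ (suc d)))
    (ℚᵘ.≃-trans (ℚᵘ.*≡* eq) (ℚᵘ.≃-sym (ι≃ c)))))
    where
      eq : (+ c ℤ.* + suc d) ℤ.* + 1 ≡ + c ℤ.* + suc (d ℕ.* 1)
      eq = trans (ℤP.*-identityʳ _) (cong (λ k → + c ℤ.* + suc k) (sym (ℕP.*-identityʳ d)))

module Rationals where

  open import Data.Nat as ℕ using (ℕ; zero; suc)
  import Data.Nat.Properties as ℕP
  open import Data.Integer using (+_)
  open import Data.Rational using (ℚ; 0ℚ; 1ℚ; _+_; _*_; _-_; -_; _/_; _≤_; ∣_∣; nonNegative; positive)
  open import Data.Rational.Properties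
  open import Data.Sum using (inj₁; inj₂)
  open import Relation.Binary.PropositionalEquality
  open import Data.Rational.Solver using (module +-*-Solver)
  open +-*-Solver
  open NaturalEmbedding

  ≤-by : ∀ {x x' y y'} → x ≡ x' → y ≡ y' → x' ≤ y' → x ≤ y
  ≤-by refl refl x'≤y' = x'≤y'

  abs-≤ : ∀ {a x} → - a ≤ x → x ≤ a → ∣ x ∣ ≤ a
  abs-≤ {a} {x} lo hi with ∣p∣≡p∨∣p∣≡-p x
  ... | inj₁ ∣x∣≡x  = subst (_≤ a) (sym ∣x∣≡x) hi
  ... | inj₂ ∣x∣≡-x = subst (_≤ a) (sym ∣x∣≡-x) (subst (- x ≤_) (solve 1 (λ y → :- (:- y) := y) refl a) (neg-antimono-≤ lo))

  +-cancelˡ-≤ : ∀ c {x y} → c + x ≤ c + y → x ≤ y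
  +-cancelˡ-≤ c {x} {y} c+x≤c+y =
    ≤-by (solve 2 (λ c x → x := (c :+ x) :+ (:- c)) refl c x) (solve 2 (λ c y → y := (c :+ y) :+ (:- c)) refl c y)
      (+-monoˡ-≤ (- c) c+x≤c+y)

  *-nonNeg : ∀ {p q} → 0ℚ ≤ p → 0ℚ ≤ q → 0ℚ ≤ p * q
  *-nonNeg {p} {q} 0≤p 0≤q =
    nonNegative⁻¹ _ {{nonNeg*nonNeg⇒nonNeg p {{nonNegative 0≤p}} q {{nonNegative 0≤q}}}}

  *-monoˡ : ∀ {r p q} → 0ℚ ≤ r → p ≤ q → r * p ≤ r * q
  *-monoˡ {r} 0≤r = *-monoˡ-≤-nonNeg r {{nonNegative 0≤r}}

  *-monoʳ : ∀ {r p q} → 0ℚ ≤ r → p ≤ q → p * r ≤ q * r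
  *-monoʳ {r} 0≤r = *-monoʳ-≤-nonNeg r {{nonNegative 0≤r}}

  inverse-antitone : ∀ {p q A B} → 0ℚ ≤ p → 0ℚ ≤ q → p * A ≡ 1ℚ → q * B ≡ 1ℚ → B ≤ A → p ≤ q
  inverse-antitone {p} {q} {A} {B} 0≤p 0≤q pA≡1 qB≡1 B≤A = begin
    p             ≡⟨ sym (*-identityʳ p) ⟩
    p * 1ℚ        ≡⟨ cong (p *_) (sym qB≡1) ⟩
    p * (q * B)   ≡⟨ sym (*-assoc p q B) ⟩
    (p * q) * B   ≤⟨ *-monoˡ (*-nonNeg 0≤p 0≤q) B≤A ⟩
    (p * q) * A   ≡⟨ solve 3 (λ x y z → (x :* y) :* z := y :* (x :* z)) refl p q A ⟩
    q * (p * A)   ≡⟨ cong (q *_) pA≡1 ⟩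
    q * 1ℚ        ≡⟨ *-identityʳ q ⟩
    q ∎
    where open ≤-Reasoning

  inverse-unique : ∀ {p q A} → p * A ≡ 1ℚ → q * A ≡ 1ℚ → p ≡ q
  inverse-unique {p} {q} {A} pA≡1 qA≡1 = begin
    p             ≡⟨ sym (*-identityʳ p) ⟩
    p * 1ℚ        ≡⟨ cong (p *_) (sym qA≡1) ⟩
    p * (q * A)   ≡⟨ solve 3 (λ x y z → x :* (y :* z) := y :* (x :* z)) refl p q A ⟩
    q * (p * A)   ≡⟨ cong (q *_) pA≡1 ⟩
    q * 1ℚ        ≡⟨ *-identityʳ q ⟩
    q ∎
    where open ≡-Reasoning

  0≤fraction : ∀ c d .{{_ : ℕ.NonZero d}} → 0ℚ ≤ (+ c) / d
  0≤fraction c d = nonNegative⁻¹ _ {{normalize-nonNeg c d}}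

  -- The reciprocal 1/n of a natural number (0 for n = 0).
  recip : ℕ → ℚ
  recip zero    = 0ℚ
  recip (suc n) = (+ 1) / suc n

  recip-inverse : ∀ n → 1 ℕ.≤ n → recip n * ι n ≡ 1ℚ
  recip-inverse (suc n) _ = trans (fraction-*-denominator 1 (suc n)) ι-1

  0≤recip : ∀ n → 0ℚ ≤ recip n
  0≤recip zero    = ≤-refl
  0≤recip (suc n) = 0≤fraction 1 (suc n)

  recip-antitone : ∀ {m n} → 1 ℕ.≤ m → m ℕ.≤ n → recip n ≤ recip m
  recip-antitone {m} {n} 1≤m m≤n =
    inverse-antitone (0≤recip n) (0≤recip m) (recip-inverse n (ℕP.≤-trans 1≤m m≤n)) (recip-inverse m 1≤m) (ι-mono m≤n)

  recip-scale : ∀ c m → 1 ℕ.≤ m → 1 ℕ.≤ c → ι c * recip (c ℕ.* m) ≡ recip m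
  recip-scale c m 1≤m 1≤c = inverse-unique (begin
      ι c * recip (c ℕ.* m) * ι m   ≡⟨ solve 3 (λ a x b → a :* x :* b := x :* (a :* b)) refl (ι c) (recip (c ℕ.* m)) (ι m) ⟩
      recip (c ℕ.* m) * (ι c * ι m) ≡⟨ cong (recip (c ℕ.* m) *_) (sym (ι-* c m)) ⟩
      recip (c ℕ.* m) * ι (c ℕ.* m) ≡⟨ recip-inverse (c ℕ.* m) (ℕP.*-mono-≤ 1≤c 1≤m) ⟩
      1ℚ ∎) (recip-inverse m 1≤m)
    where open ≡-Reasoning

  *-cancelʳ-ι : ∀ {x y} n → 1 ℕ.≤ n → x * ι n ≡ y * ι n → x ≡ y
  *-cancelʳ-ι n 1≤n eq = ≤-antisym (*-cancelʳ-≤-pos (ι n) {{positive (0<ι n 1≤n)}} (≤-reflexive eq))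
                                   (*-cancelʳ-≤-pos (ι n) {{positive (0<ι n 1≤n)}} (≤-reflexive (sym eq)))

  sumℚ : (ℕ → ℚ) → ℕ → ℚ
  sumℚ f zero    = 0ℚ
  sumℚ f (suc n) = sumℚ f n + f (suc n)

  sumℚ-mono : ∀ f g n → (∀ d → 1 ℕ.≤ d → d ℕ.≤ n → f d ≤ g d) → sumℚ f n ≤ sumℚ g n
  sumℚ-mono f g zero    _   = ≤-refl
  sumℚ-mono f g (suc n) f≤g =
    +-mono-≤ (sumℚ-mono f g n λ d 1≤d d≤n → f≤g d 1≤d (ℕP.m≤n⇒m≤1+n d≤n)) (f≤g (suc n) (ℕ.s≤s ℕ.z≤n) ℕP.≤-refl)

  sumℚ-+ : ∀ f g n → sumℚ (λ d → f d + g d) n ≡ sumℚ f n + sumℚ g n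
  sumℚ-+ f g zero    = sym (+-identityˡ 0ℚ)
  sumℚ-+ f g (suc n) rewrite sumℚ-+ f g n =
    solve 4 (λ a b c d → (a :+ b) :+ (c :+ d) := (a :+ c) :+ (b :+ d)) refl (sumℚ f n) (sumℚ g n) (f (suc n)) (g (suc n))

  sumℚ-scale : ∀ c f n → sumℚ (λ d → c * f d) n ≡ c * sumℚ f n
  sumℚ-scale c f zero    = sym (*-zeroʳ c)
  sumℚ-scale c f (suc n) rewrite sumℚ-scale c f n = sym (*-distribˡ-+ c (sumℚ f n) (f (suc n)))

  sumℚ-neg : ∀ f n → sumℚ (λ d → - f d) n ≡ - sumℚ f n
  sumℚ-neg f zero    = refl
  sumℚ-neg f (suc n) rewrite sumℚ-neg f n = sym (neg-distrib-+ (sumℚ f n) (f (suc n)))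

  sumℚ-split : ∀ f a k → sumℚ f (a ℕ.+ k) ≡ sumℚ f a + sumℚ (λ i → f (a ℕ.+ i)) k
  sumℚ-split f a zero    rewrite ℕP.+-identityʳ a = sym (+-identityʳ (sumℚ f a))
  sumℚ-split f a (suc k) rewrite ℕP.+-suc a k | sumℚ-split f a k = +-assoc (sumℚ f a) _ _

  sumℚ-first : ∀ f n → sumℚ f (suc n) ≡ f 1 + sumℚ (λ i → f (suc i)) n
  sumℚ-first f n = trans (sumℚ-split f 1 n) (cong (_+ sumℚ (λ i → f (suc i)) n) (+-identityˡ (f 1)))

  sumℚ-const : ∀ c n → sumℚ (λ _ → c) n ≡ ι n * c
  sumℚ-const c zero    = sym (*-zeroˡ c)
  sumℚ-const c (suc n) rewrite sumℚ-const c n = solve 2 (λ x y → x :* y :+ y := (con 1ℚ :+ x) :* y) refl (ι n) c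

  sumℚ-nonNeg : ∀ f n → (∀ d → 1 ℕ.≤ d → d ℕ.≤ n → 0ℚ ≤ f d) → 0ℚ ≤ sumℚ f n
  sumℚ-nonNeg f n 0≤f = ≤-by (sym (trans (sumℚ-const 0ℚ n) (*-zeroʳ (ι n)))) refl (sumℚ-mono (λ _ → 0ℚ) f n 0≤f)

  sumℚ-abs : ∀ f n → ∣ sumℚ f n ∣ ≤ sumℚ (λ d → ∣ f d ∣) n
  sumℚ-abs f zero    = ≤-refl
  sumℚ-abs f (suc n) = ≤-trans (∣p+q∣≤∣p∣+∣q∣ (sumℚ f n) (f (suc n))) (+-monoˡ-≤ ∣ f (suc n) ∣ (sumℚ-abs f n))

module ZetaPartial where

  open import Data.Nat as ℕ using (ℕ; zero; suc)
  import Data.Nat.Properties as ℕP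
  open import Data.Integer using (+_)
  open import Data.Rational using (ℚ; 0ℚ; 1ℚ; _+_; _*_; _/_; _≤_)
  open import Data.Rational.Properties
  open import Data.Product using (_,_)
  open import Relation.Binary.PropositionalEquality
  open import Data.Rational.Solver using (module +-*-Solver)
  open +-*-Solver
  open import Defs using (zetaPartial)
  open NaturalEmbedding
  open Rationals

  ζ-term : ℕ → ℕ → ℚ
  ζ-term b zero    = 0ℚ
  ζ-term b (suc m) = (+ 1) / (suc m ℕ.^ b)
    where instance _ = ℕP.m^n≢0 (suc m) b

  ζ : ℕ → ℕ → ℚ
  ζ b n = sumℚ (ζ-term b) n

  ζ≡zetaPartial : ∀ b n → zetaPartial b n ≡ ζ b n
  ζ≡zetaPartial b zero    = refl
  ζ≡zetaPartial b (suc n) = cong (_+ ζ-term b (suc n)) (ζ≡zetaPartial b n)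

  ζ-term-inverse : ∀ b d → 1 ℕ.≤ d → ζ-term b d * ι (d ℕ.^ b) ≡ 1ℚ
  ζ-term-inverse b (suc m) _ =
    trans (fraction-*-denominator 1 (suc m ℕ.^ b) {{ℕP.m^n≢0 (suc m) b}}) ι-1

  0≤ζ-term : ∀ b d → 0ℚ ≤ ζ-term b d
  0≤ζ-term b zero    = ≤-refl
  0≤ζ-term b (suc m) = 0≤fraction 1 (suc m ℕ.^ b) {{ℕP.m^n≢0 (suc m) b}}

  ι-*-ζ-term : ∀ b d x → 1 ℕ.≤ d → ι (x ℕ.* d ℕ.^ b) * ζ-term b d ≡ ι x
  ι-*-ζ-term b d x 1≤d = begin
    ι (x ℕ.* d ℕ.^ b) * ζ-term b d       ≡⟨ cong (_* ζ-term b d) (ι-* x (d ℕ.^ b)) ⟩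
    ι x * ι (d ℕ.^ b) * ζ-term b d       ≡⟨ solve 3 (λ p q r → p :* q :* r := p :* (r :* q)) refl (ι x) (ι (d ℕ.^ b)) (ζ-term b d) ⟩
    ι x * (ζ-term b d * ι (d ℕ.^ b))     ≡⟨ cong (ι x *_) (ζ-term-inverse b d 1≤d) ⟩
    ι x * 1ℚ                             ≡⟨ *-identityʳ (ι x) ⟩
    ι x ∎
    where open ≡-Reasoning

  ζ-term-1 : ∀ b → ζ-term b 1 ≡ 1ℚ
  ζ-term-1 b = trans (sym (*-identityʳ (ζ-term b 1)))
    (trans (cong (ζ-term b 1 *_) (sym (trans (cong ι (ℕP.^-zeroˡ b)) ι-1))) (ζ-term-inverse b 1 (ℕ.s≤s ℕ.z≤n)))

  ζ-1 : ∀ b → ζ b 1 ≡ 1ℚ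
  ζ-1 b = trans (+-identityˡ (ζ-term b 1)) (ζ-term-1 b)

  ζ-mono : ∀ b {T M} → T ℕ.≤ M → ζ b T ≤ ζ b M
  ζ-mono b {T} T≤M with ℕP.m≤n⇒∃[o]m+o≡n T≤M
  ... | k , refl = ≤-by (sym (+-identityʳ (ζ b T))) (sumℚ-split (ζ-term b) T k)
                     (+-monoʳ-≤ (ζ b T) (sumℚ-nonNeg _ k λ d _ _ → 0≤ζ-term b (T ℕ.+ d)))

  1≤ζ : ∀ b {M} → 1 ℕ.≤ M → 1ℚ ≤ ζ b M
  1≤ζ b {M} 1≤M = subst (_≤ ζ b M) (ζ-1 b) (ζ-mono b 1≤M)

  -- (1/m) (1/(m+1)) + 1/(m+1) = 1/m, i.e. 1/m − 1/(m+1) = 1/(m(m+1)).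
  recip-telescope : ∀ m → 1 ℕ.≤ m → recip m * recip (suc m) + recip (suc m) ≡ recip m
  recip-telescope m 1≤m = begin
    v * w + w                ≡⟨ cong (_+_ (v * w)) (sym (*-identityʳ w)) ⟩
    v * w + w * 1ℚ           ≡⟨ cong (λ z → v * w + w * z) (sym (recip-inverse m 1≤m)) ⟩
    v * w + w * (v * ι m)    ≡⟨ solve 3 (λ a b c → a :* b :+ b :* (a :* c) := a :* (b :* (con 1ℚ :+ c))) refl v w (ι m) ⟩
    v * (w * ι (suc m))      ≡⟨ cong (v *_) (recip-inverse (suc m) (ℕ.s≤s ℕ.z≤n)) ⟩
    v * 1ℚ                   ≡⟨ *-identityʳ v ⟩
    v ∎
    where
      open ≡-Reasoning
      v = recip m
      w = recip (suc m)

  -- For b ≥ 2: 1/(m+1)^b ≤ 1/(m(m+1)), since m(m+1) ≤ (m+1)^b.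
  ζ-term-≤-telescope : ∀ b m → 2 ℕ.≤ b → 1 ℕ.≤ m → ζ-term b (suc m) ≤ recip m * recip (suc m)
  ζ-term-≤-telescope b m 2≤b 1≤m = inverse-antitone (0≤ζ-term b (suc m)) (*-nonNeg (0≤recip m) (0≤recip (suc m)))
    (ζ-term-inverse b (suc m) (ℕ.s≤s ℕ.z≤n)) product-inverse (ι-mono (m*[m+1]≤[m+1]^b b 2≤b))
    where
      m*[m+1]≤[m+1]^b : ∀ b → 2 ℕ.≤ b → m ℕ.* suc m ℕ.≤ suc m ℕ.^ b
      m*[m+1]≤[m+1]^b (suc zero) (ℕ.s≤s ())
      m*[m+1]≤[m+1]^b (suc (suc b)) _ = ℕP.≤-trans (ℕP.*-monoˡ-≤ (suc m) (ℕP.n≤1+n m))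
        (ℕP.*-monoʳ-≤ (suc m) (ℕP.m≤m*n (suc m) (suc m ℕ.^ b) {{ℕP.m^n≢0 (suc m) b}}))
      product-inverse : recip m * recip (suc m) * ι (m ℕ.* suc m) ≡ 1ℚ
      product-inverse = begin
        recip m * recip (suc m) * ι (m ℕ.* suc m)         ≡⟨ cong (recip m * recip (suc m) *_) (ι-* m (suc m)) ⟩
        recip m * recip (suc m) * (ι m * ι (suc m))       ≡⟨ solve 4 (λ a b c d → a :* b :* (c :* d) := a :* c :* (b :* d))
                                                               refl (recip m) (recip (suc m)) (ι m) (ι (suc m)) ⟩
        recip m * ι m * (recip (suc m) * ι (suc m))       ≡⟨ cong₂ _*_ (recip-inverse m 1≤m) (recip-inverse (suc m) (ℕ.s≤s ℕ.z≤n)) ⟩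
        1ℚ * 1ℚ                                           ≡⟨ *-identityˡ 1ℚ ⟩
        1ℚ ∎
        where open ≡-Reasoning

  ζ+recip-antitone : ∀ b {T M} → 2 ℕ.≤ b → 1 ℕ.≤ T → T ℕ.≤′ M → ζ b M + recip M ≤ ζ b T + recip T
  ζ+recip-antitone b 2≤b 1≤T ℕ.≤′-refl = ≤-refl
  ζ+recip-antitone b {T} {suc M} 2≤b 1≤T (ℕ.≤′-step T≤M) = begin
    ζ b M + ζ-term b (suc M) + recip (suc M)     ≡⟨ +-assoc (ζ b M) _ _ ⟩
    ζ b M + (ζ-term b (suc M) + recip (suc M))   ≤⟨ +-monoʳ-≤ (ζ b M) (≤-by refl (sym (recip-telescope M 1≤M))
                                                      (+-monoˡ-≤ (recip (suc M)) (ζ-term-≤-telescope b M 2≤b 1≤M))) ⟩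
    ζ b M + recip M                              ≤⟨ ζ+recip-antitone b 2≤b 1≤T T≤M ⟩
    ζ b T + recip T ∎
    where
      open ≤-Reasoning
      1≤M = ℕP.≤-trans 1≤T (ℕP.≤′⇒≤ T≤M)

  ζ-tail : ∀ b {T M} → 2 ℕ.≤ b → 1 ℕ.≤ T → T ℕ.≤ M → ζ b M ≤ ζ b T + recip T
  ζ-tail b {T} {M} 2≤b 1≤T T≤M = ≤-trans (≤-by (sym (+-identityʳ (ζ b M))) refl (+-monoʳ-≤ (ζ b M) (0≤recip M)))
    (ζ+recip-antitone b 2≤b 1≤T (ℕP.≤⇒≤′ T≤M))

  ζ≤2 : ∀ b {M} → 2 ℕ.≤ b → 1 ℕ.≤ M → ζ b M ≤ 1ℚ + 1ℚ
  ζ≤2 b {M} 2≤b 1≤M = subst (λ z → ζ b M ≤ z + recip 1) (ζ-1 b) (ζ-tail b 2≤b ℕP.≤-refl 1≤M)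

  -- For b ≥ 2, ζ(b) − 1 = Σ_{d ≥ 2} 1/d^b ≤ 1/4 + 1/2 = 3/4 < 1: this is what makes
  -- the error recursion below contract.
  ζ-1≤¾ : ∀ b T → 2 ℕ.≤ b → sumℚ (λ i → ζ-term b (suc i)) T ≤ (+ 3) / 4
  ζ-1≤¾ b zero        2≤b = 0≤fraction 3 4
  ζ-1≤¾ b T@(suc T') 2≤b = +-cancelˡ-≤ 1ℚ (begin
    1ℚ + sumℚ (λ i → ζ-term b (suc i)) T          ≡⟨ cong (_+ sumℚ (λ i → ζ-term b (suc i)) T) (ζ-term-1 b) ⟨
    ζ-term b 1 + sumℚ (λ i → ζ-term b (suc i)) T  ≡⟨ sumℚ-first (ζ-term b) T ⟨
    ζ b (suc T)                                   ≤⟨ ζ-tail b {2} {suc T} 2≤b (ℕ.s≤s ℕ.z≤n) (ℕ.s≤s (ℕ.s≤s ℕ.z≤n)) ⟩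
    ζ b 2 + recip 2                               ≡⟨ cong (λ z → z + ζ-term b 2 + recip 2) (ζ-1 b) ⟩
    1ℚ + ζ-term b 2 + recip 2                     ≤⟨ +-monoˡ-≤ (recip 2) (+-monoʳ-≤ 1ℚ ζ-term-2≤¼) ⟩
    1ℚ + (+ 1) / 4 + recip 2                      ≡⟨ +-assoc 1ℚ ((+ 1) / 4) (recip 2) ⟩
    1ℚ + (+ 3) / 4                                ∎)
    where
      open ≤-Reasoning
      ζ-term-2≤¼ : ζ-term b 2 ≤ (+ 1) / 4
      ζ-term-2≤¼ = inverse-antitone (0≤ζ-term b 2) (0≤fraction 1 4) (ζ-term-inverse b 2 (ℕ.s≤s ℕ.z≤n))
        (trans (fraction-*-denominator 1 4) ι-1) (ι-mono {4} {2 ℕ.^ b} (ℕP.^-monoʳ-≤ 2 2≤b))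

  -- For b = 1 the partial sums are harmonic numbers, which are unbounded:
  -- H_{2n} ≥ H_n + n · 1/(2n) = H_n + 1/2, so H_{4^m} ≥ 1 + m.
  ζ-term-1-recip : ∀ d → 1 ℕ.≤ d → ζ-term 1 d ≡ recip d
  ζ-term-1-recip d 1≤d =
    inverse-unique (subst (λ z → ζ-term 1 d * ι z ≡ 1ℚ) (ℕP.*-identityʳ d) (ζ-term-inverse 1 d 1≤d)) (recip-inverse d 1≤d)

  harmonic-doubling : ∀ n → 1 ℕ.≤ n → ζ 1 n + recip 2 ≤ ζ 1 (n ℕ.+ n)
  harmonic-doubling n 1≤n = ≤-by refl (sumℚ-split (ζ-term 1) n n) (+-monoʳ-≤ (ζ 1 n) (begin
    recip 2                               ≡⟨ recip-scale n 2 (ℕ.s≤s ℕ.z≤n) 1≤n ⟨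
    ι n * recip (n ℕ.* 2)                 ≡⟨ cong (λ z → ι n * recip z) (ℕP.*-comm n 2) ⟩
    ι n * recip (2 ℕ.* n)                 ≡⟨ cong (λ z → ι n * recip z) (cong (n ℕ.+_) (ℕP.+-identityʳ n)) ⟩
    ι n * recip (n ℕ.+ n)                 ≡⟨ sumℚ-const (recip (n ℕ.+ n)) n ⟨
    sumℚ (λ _ → recip (n ℕ.+ n)) n        ≤⟨ sumℚ-mono _ _ n (λ i _ i≤n → subst (recip (n ℕ.+ n) ≤_)
                                               (sym (ζ-term-1-recip (n ℕ.+ i) (ℕP.≤-trans 1≤n (ℕP.m≤m+n n i))))
                                               (recip-antitone (ℕP.≤-trans 1≤n (ℕP.m≤m+n n i)) (ℕP.+-monoʳ-≤ n i≤n))) ⟩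
    sumℚ (λ i → ζ-term 1 (n ℕ.+ i)) n ∎))
    where open ≤-Reasoning

  harmonic-growth : ∀ j → 1ℚ + ι j * recip 2 ≤ ζ 1 (2 ℕ.^ j)
  harmonic-growth zero    = ≤-by (trans (cong (_+_ 1ℚ) (*-zeroˡ (recip 2))) (+-identityʳ 1ℚ)) (ζ-1 1) ≤-refl
  harmonic-growth (suc j) = begin
    1ℚ + ι (suc j) * recip 2    ≡⟨ solve 2 (λ a x → con 1ℚ :+ (con 1ℚ :+ a) :* x := (con 1ℚ :+ a :* x) :+ x) refl (ι j) (recip 2) ⟩
    1ℚ + ι j * recip 2 + recip 2 ≤⟨ +-monoˡ-≤ (recip 2) (harmonic-growth j) ⟩
    ζ 1 P + recip 2              ≤⟨ harmonic-doubling P (ℕP.m^n>0 2 j) ⟩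
    ζ 1 (P ℕ.+ P)                ≡⟨ cong (λ z → ζ 1 (P ℕ.+ z)) (sym (ℕP.+-identityʳ P)) ⟩
    ζ 1 (2 ℕ.^ suc j) ∎
    where
      open ≤-Reasoning
      P = 2 ℕ.^ j

  harmonic-unbounded : ∀ m → ι m ≤ ζ 1 (2 ℕ.^ (2 ℕ.* m))
  harmonic-unbounded m = ≤-trans (≤-by (sym (+-identityˡ (ι m))) refl (+-monoˡ-≤ (ι m) 0≤1))
                                 (≤-by (cong (_+_ 1ℚ) m≡2m/2) refl (harmonic-growth (2 ℕ.* m)))
    where
      m≡2m/2 : ι m ≡ ι (2 ℕ.* m) * recip 2
      m≡2m/2 = sym (begin
        ι (2 ℕ.* m) * recip 2      ≡⟨ cong (_* recip 2) (ι-* 2 m) ⟩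
        ι 2 * ι m * recip 2        ≡⟨ solve 3 (λ a b c → a :* b :* c := b :* (c :* a)) refl (ι 2) (ι m) (recip 2) ⟩
        ι m * (recip 2 * ι 2)      ≡⟨ cong (ι m *_) (recip-inverse 2 (ℕ.s≤s ℕ.z≤n)) ⟩
        ι m * 1ℚ                   ≡⟨ *-identityʳ (ι m) ⟩
        ι m ∎)
        where open ≡-Reasoning

-- From the counting identity,
--   E_M(N) = R − Σ_{d=2}^{N} E_M(⌊N/d^b⌋),   R = ζ_M N − Σ_{d ≤ N} ⌊N/d^b⌋,
-- where |R| is small; bounding the terms with d ≤ T by β ⌊N/d^b⌋ and the
-- others trivially gives |E_M(N)| ≤ (3/T + (3/4) β) N, and iterating this
-- contraction drives β down to 12/T + (3/4)^j.
module ErrorRecursion where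

  open import Data.Nat as ℕ using (ℕ; zero; suc)
  import Data.Nat.Properties as ℕP
  open import Data.Integer using (+_)
  open import Data.Rational using (ℚ; 0ℚ; 1ℚ; _+_; _*_; _-_; -_; _/_; _≤_; ∣_∣)
  open import Data.Rational.Properties
  open import Data.Product using (_,_)
  open import Relation.Binary.PropositionalEquality
  open import Data.Rational.Solver using (module +-*-Solver)
  open +-*-Solver
  open PowerFree using (1≤^)
  open Counting using (Q; Q≤; _div₀_; div₀-floor; div₀-ceil; div₀-≥; div₀-1; sumℕ; counting-identity)
  open NaturalEmbedding
  open Rationals
  open ZetaPartial

  ι-sumℕ : ∀ f n → ι (sumℕ f n) ≡ sumℚ (λ d → ι (f d)) n
  ι-sumℕ f zero    = refl
  ι-sumℕ f (suc n) = trans (ι-+ (sumℕ f n) (f (suc n))) (cong (_+ ι (f (suc n))) (ι-sumℕ f n))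

  E : ℕ → ℕ → ℕ → ℚ
  E b M n = ζ b M * ι (Q b n) - ι n

  -- Trivially |E_M(n)| ≤ n, because 0 ≤ ζ_M Q(n) ≤ 2n.
  E-trivial : ∀ b M n → 2 ℕ.≤ b → 1 ℕ.≤ M → ∣ E b M n ∣ ≤ ι n
  E-trivial b M n 2≤b 1≤M = abs-≤ lower upper
    where
      0≤ζQ : 0ℚ ≤ ζ b M * ι (Q b n)
      0≤ζQ = *-nonNeg (≤-trans 0≤1 (1≤ζ b 1≤M)) (0≤ι (Q b n))
      lower : - ι n ≤ E b M n
      lower = ≤-by (sym (+-identityˡ (- ι n))) refl (+-monoˡ-≤ (- ι n) 0≤ζQ)
      ζQ≤2n : ζ b M * ι (Q b n) ≤ (1ℚ + 1ℚ) * ι n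
      ζQ≤2n = ≤-trans (*-monoʳ (0≤ι (Q b n)) (ζ≤2 b 2≤b 1≤M))
                      (*-monoˡ (≤-by (sym (+-identityˡ 0ℚ)) refl (+-mono-≤ 0≤1 0≤1)) (ι-mono (Q≤ b n)))
      upper : E b M n ≤ ι n
      upper = ≤-by refl (sym (solve 1 (λ x → (con 1ℚ :+ con 1ℚ) :* x :- x := x) refl (ι n))) (+-monoˡ-≤ (- ι n) ζQ≤2n)

  -- The contraction factor, an upper bound for ζ(b) − 1.
  α : ℚ
  α = (+ 3) / 4

  0≤α : 0ℚ ≤ α
  0≤α = 0≤fraction 3 4

  -- One contraction step.  Here T = T' + 1 ≤ M, N = T + k with T² ≤ N and
  -- T^b K ≤ N, and the hypothesis bounds |E_M(n)| ≤ β n for all n ≥ K.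
  module ContractionStep (b M T' k K : ℕ) (β : ℚ) (2≤b : 2 ℕ.≤ b) (T≤M : suc T' ℕ.≤ M)
    (T²≤N : suc T' ℕ.* suc T' ℕ.≤ suc (T' ℕ.+ k)) (T^bK≤N : suc T' ℕ.^ b ℕ.* K ℕ.≤ suc (T' ℕ.+ k))
    (0≤β : 0ℚ ≤ β) (hypothesis : ∀ n → K ℕ.≤ n → ∣ E b M n ∣ ≤ β * ι n) where

    T N : ℕ
    T = suc T'
    N = suc (T' ℕ.+ k)

    1≤T : 1 ℕ.≤ T
    1≤T = ℕ.s≤s ℕ.z≤n

    1≤M : 1 ℕ.≤ M
    1≤M = ℕP.≤-trans 1≤T T≤M

    1≤b : 1 ℕ.≤ b
    1≤b = ℕP.≤-trans (ℕ.s≤s ℕ.z≤n) 2≤b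

    T≤N : T ℕ.≤ N
    T≤N = ℕ.s≤s (ℕP.m≤m+n T' k)

    quot : ℕ → ℕ
    quot d = N div₀ d ℕ.^ b

    F : ℕ → ℚ
    F d = ι (quot d)

    e : ℕ → ℚ
    e d = E b M (quot d)

    A w : ℚ
    A = ι N
    w = recip T

    0≤A : 0ℚ ≤ A
    0≤A = 0≤ι N

    F-upper : ∀ d → 1 ℕ.≤ d → F d ≤ A * ζ-term b d
    F-upper d 1≤d = ≤-by (sym (ι-*-ζ-term b d (quot d) 1≤d)) refl
      (*-monoʳ (0≤ζ-term b d) (ι-mono (div₀-floor N (d ℕ.^ b))))

    F-lower : ∀ d → 1 ℕ.≤ d → A * ζ-term b d ≤ F d + 1ℚ
    F-lower d 1≤d = ≤-by refl (trans (+-comm (F d) 1ℚ) (sym (ι-*-ζ-term b d (suc (quot d)) 1≤d)))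
      (*-monoʳ (0≤ζ-term b d) (ι-mono (ℕP.<⇒≤ (div₀-ceil N (d ℕ.^ b) (1≤^ d b 1≤d)))))

    S : ℚ
    S = sumℚ F N

    R : ℚ
    R = ζ b M * A - S

    Σe≡R : sumℚ e N ≡ R
    Σe≡R = begin
      sumℚ e N
        ≡⟨ sumℚ-+ (λ d → ζ b M * ι (Q b (quot d))) (λ d → - F d) N ⟩
      sumℚ (λ d → ζ b M * ι (Q b (quot d))) N + sumℚ (λ d → - F d) N
        ≡⟨ cong₂ _+_ (sumℚ-scale (ζ b M) (λ d → ι (Q b (quot d))) N) (sumℚ-neg F N) ⟩
      ζ b M * sumℚ (λ d → ι (Q b (quot d))) N - S
        ≡⟨ cong (λ z → ζ b M * z - S) ΣQ≡N ⟩
      R ∎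
      where
        open ≡-Reasoning
        ΣQ≡N : sumℚ (λ d → ι (Q b (quot d))) N ≡ A
        ΣQ≡N = trans (sym (ι-sumℕ (λ d → Q b (quot d)) N)) (cong ι (counting-identity b 1≤b N N ℕP.≤-refl))

    -- |R| ≤ N/T + T: both ζ_M and Σ_{d ≤ N} ⌊N/d^b⌋ / N are within 1/T of ζ_T.
    S≤Aζ_N : S ≤ A * ζ b N
    S≤Aζ_N = subst (S ≤_) (sumℚ-scale A (ζ-term b) N) (sumℚ-mono F (λ d → A * ζ-term b d) N λ d 1≤d _ → F-upper d 1≤d)

    Aζ_T≤S+T : A * ζ b T ≤ S + ι T
    Aζ_T≤S+T = begin
      A * ζ b T                        ≡⟨ sumℚ-scale A (ζ-term b) T ⟨
      sumℚ (λ d → A * ζ-term b d) T    ≤⟨ sumℚ-mono _ _ T (λ d 1≤d _ → F-lower d 1≤d) ⟩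
      sumℚ (λ d → F d + 1ℚ) T          ≡⟨ sumℚ-+ F (λ _ → 1ℚ) T ⟩
      sumℚ F T + sumℚ (λ _ → 1ℚ) T     ≡⟨ cong (_+_ (sumℚ F T)) (trans (sumℚ-const 1ℚ T) (*-identityʳ (ι T))) ⟩
      sumℚ F T + ι T                   ≤⟨ +-monoˡ-≤ (ι T) Σ_T≤Σ_N ⟩
      S + ι T ∎
      where
        open ≤-Reasoning
        Σ_T≤Σ_N : sumℚ F T ≤ S
        Σ_T≤Σ_N = ≤-by (sym (+-identityʳ (sumℚ F T))) (sumℚ-split F T k)
                    (+-monoʳ-≤ (sumℚ F T) (sumℚ-nonNeg _ k λ d _ _ → 0≤ι (quot (T ℕ.+ d))))

    R-upper : R ≤ A * w + ι T
    R-upper = ≤-by eqL eqR (+-monoˡ-≤ (- S - A * ζ b T) (+-mono-≤ (*-monoʳ 0≤A (ζ-tail b 2≤b 1≤T T≤M)) Aζ_T≤S+T))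
      where
        eqL : R ≡ (ζ b M * A + A * ζ b T) + (- S - A * ζ b T)
        eqL = solve 4 (λ zm a s zt → zm :* a :- s := (zm :* a :+ a :* zt) :+ (:- s :- a :* zt)) refl (ζ b M) A S (ζ b T)
        eqR : A * w + ι T ≡ ((ζ b T + w) * A + (S + ι T)) + (- S - A * ζ b T)
        eqR = solve 5 (λ a ww t s zt → a :* ww :+ t := ((zt :+ ww) :* a :+ (s :+ t)) :+ (:- s :- a :* zt)) refl A w (ι T) S (ζ b T)

    R-lower : - (A * w) ≤ R
    R-lower = ≤-by eqL eqR (+-monoˡ-≤ (- S - A * w) S≤A[ζ_M+w])
      where
        S≤A[ζ_M+w] : S ≤ A * (ζ b M + w)
        S≤A[ζ_M+w] = ≤-trans S≤Aζ_N (*-monoˡ 0≤A (≤-trans (ζ-tail b 2≤b 1≤T T≤N) (+-monoˡ-≤ w (ζ-mono b T≤M))))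
        eqL : - (A * w) ≡ S + (- S - A * w)
        eqL = solve 3 (λ a ww s → :- (a :* ww) := s :+ (:- s :- a :* ww)) refl A w S
        eqR : R ≡ A * (ζ b M + w) + (- S - A * w)
        eqR = solve 4 (λ zm a s ww → zm :* a :- s := a :* (zm :+ ww) :+ (:- s :- a :* ww)) refl (ζ b M) A S w

    |R|≤ : ∣ R ∣ ≤ A * w + ι T
    |R|≤ = abs-≤ (≤-trans (neg-antimono-≤ (≤-by (sym (+-identityʳ (A * w))) refl (+-monoʳ-≤ (A * w) (0≤ι T)))) R-lower) R-upper

    -- E_M(N) = R − Σ_{d=2}^{N} E_M(⌊N/d^b⌋), since the d = 1 term is E_M(N) itself.
    S' : ℚ
    S' = sumℚ (λ i → e (suc i)) (T' ℕ.+ k)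

    E≡R-S' : E b M N ≡ R - S'
    E≡R-S' = begin
      E b M N               ≡⟨ solve 2 (λ x y → x := (x :+ y) :- y) refl (E b M N) S' ⟩
      (E b M N + S') - S'   ≡⟨ cong (λ z → (z + S') - S') (cong (E b M) (sym (trans (cong (N div₀_) (ℕP.^-zeroˡ b)) (div₀-1 N)))) ⟩
      (e 1 + S') - S'       ≡⟨ cong (_- S') (trans (sym (sumℚ-first e (T' ℕ.+ k))) Σe≡R) ⟩
      R - S' ∎
      where open ≡-Reasoning

    -- For 2 ≤ d ≤ T we have ⌊N/d^b⌋ ≥ K, so the hypothesis applies; these terms
    -- total at most β N (ζ_T − 1) ≤ (3/4) β N.
    head≤ : sumℚ (λ i → ∣ e (suc i) ∣) T' ≤ β * (A * α)
    head≤ = begin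
      sumℚ (λ i → ∣ e (suc i) ∣) T'                ≤⟨ sumℚ-mono _ _ T' term≤ ⟩
      sumℚ (λ i → β * (A * ζ-term b (suc i))) T'   ≡⟨ sumℚ-scale β (λ i → A * ζ-term b (suc i)) T' ⟩
      β * sumℚ (λ i → A * ζ-term b (suc i)) T'     ≡⟨ cong (β *_) (sumℚ-scale A (λ i → ζ-term b (suc i)) T') ⟩
      β * (A * sumℚ (λ i → ζ-term b (suc i)) T')   ≤⟨ *-monoˡ 0≤β (*-monoˡ 0≤A (ζ-1≤¾ b T' 2≤b)) ⟩
      β * (A * α) ∎
      where
        open ≤-Reasoning
        K≤quot : ∀ i → i ℕ.≤ T' → K ℕ.≤ quot (suc i)
        K≤quot i i≤T' = div₀-≥ (1≤^ (suc i) b (ℕ.s≤s ℕ.z≤n))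
          (ℕP.≤-trans (ℕP.*-monoˡ-≤ K (ℕP.^-monoˡ-≤ b (ℕ.s≤s i≤T'))) T^bK≤N)
        term≤ : ∀ i → 1 ℕ.≤ i → i ℕ.≤ T' → ∣ e (suc i) ∣ ≤ β * (A * ζ-term b (suc i))
        term≤ i _ i≤T' = ≤-trans (hypothesis (quot (suc i)) (K≤quot i i≤T')) (*-monoˡ 0≤β (F-upper (suc i) (ℕ.s≤s ℕ.z≤n)))

    -- For d > T the trivial bound gives at most N (ζ_N − ζ_T) ≤ N/T.
    tail≤ : sumℚ (λ i → ∣ e (suc (T' ℕ.+ i)) ∣) k ≤ A * w
    tail≤ = begin
      sumℚ (λ i → ∣ e (suc (T' ℕ.+ i)) ∣) k      ≤⟨ sumℚ-mono _ _ k (λ i _ _ →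
                                                      ≤-trans (E-trivial b M (quot (T ℕ.+ i)) 2≤b 1≤M) (F-upper (T ℕ.+ i) (ℕ.s≤s ℕ.z≤n))) ⟩
      sumℚ (λ i → A * ζ-term b (T ℕ.+ i)) k      ≡⟨ sumℚ-scale A (λ i → ζ-term b (T ℕ.+ i)) k ⟩
      A * sumℚ (λ i → ζ-term b (T ℕ.+ i)) k      ≤⟨ *-monoˡ 0≤A ζ_N-ζ_T≤w ⟩
      A * w ∎
      where
        open ≤-Reasoning
        ζ_N-ζ_T≤w : sumℚ (λ i → ζ-term b (T ℕ.+ i)) k ≤ w
        ζ_N-ζ_T≤w = +-cancelˡ-≤ (ζ b T) (≤-by (sym (sumℚ-split (ζ-term b) T k)) refl (ζ-tail b 2≤b 1≤T T≤N))

    |S'|≤ : ∣ S' ∣ ≤ β * (A * α) + A * w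
    |S'|≤ = ≤-trans (sumℚ-abs (λ i → e (suc i)) (T' ℕ.+ k))
      (subst (_≤ β * (A * α) + A * w) (sym (sumℚ-split (λ i → ∣ e (suc i) ∣) T' k)) (+-mono-≤ head≤ tail≤))

    T≤A*w : ι T ≤ A * w
    T≤A*w = ≤-by T≡T²/T refl (*-monoʳ (0≤recip T) (ι-mono T²≤N))
      where
        T≡T²/T : ι T ≡ ι (T ℕ.* T) * w
        T≡T²/T = begin
          ι T                 ≡⟨ sym (*-identityʳ (ι T)) ⟩
          ι T * 1ℚ            ≡⟨ cong (ι T *_) (sym (recip-inverse T 1≤T)) ⟩
          ι T * (w * ι T)     ≡⟨ solve 2 (λ t ww → t :* (ww :* t) := t :* t :* ww) refl (ι T) w ⟩
          ι T * ι T * w       ≡⟨ cong (_* w) (sym (ι-* T T)) ⟩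
          ι (T ℕ.* T) * w ∎
          where open ≡-Reasoning

    contraction : ∣ E b M N ∣ ≤ (ι 3 * w + α * β) * A
    contraction = begin
      ∣ E b M N ∣                                    ≡⟨ cong ∣_∣ E≡R-S' ⟩
      ∣ R - S' ∣                                     ≤⟨ ∣p-q∣≤∣p∣+∣q∣ R S' ⟩
      ∣ R ∣ + ∣ S' ∣                                 ≤⟨ +-mono-≤ |R|≤ |S'|≤ ⟩
      (A * w + ι T) + (β * (A * α) + A * w)          ≤⟨ +-monoˡ-≤ (β * (A * α) + A * w) (+-monoʳ-≤ (A * w) T≤A*w) ⟩
      (A * w + A * w) + (β * (A * α) + A * w)        ≡⟨ solve 4 (λ a ww bb al → (a :* ww :+ a :* ww) :+ (bb :* (a :* al) :+ a :* ww)
                                                          := ((con 1ℚ :+ (con 1ℚ :+ (con 1ℚ :+ con 0ℚ))) :* ww :+ al :* bb) :* a) refl A w β α ⟩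
      (ι 3 * w + α * β) * A ∎
      where open ≤-Reasoning

  -- Iterating the contraction j times from the trivial bound (β₀ = 1, K₀ = 0).
  β-seq : ℕ → ℕ → ℚ
  β-seq T zero    = 1ℚ
  β-seq T (suc j) = ι 3 * recip T + α * β-seq T j

  K-seq : ℕ → ℕ → ℕ → ℕ
  K-seq b T zero    = 0
  K-seq b T (suc j) = T ℕ.^ b ℕ.* K-seq b T j ℕ.+ T ℕ.* T

  0≤β-seq : ∀ T j → 0ℚ ≤ β-seq T j
  0≤β-seq T zero    = 0≤1
  0≤β-seq T (suc j) = ≤-by (sym (+-identityˡ 0ℚ)) refl
    (+-mono-≤ (*-nonNeg (0≤ι 3) (0≤recip T)) (*-nonNeg 0≤α (0≤β-seq T j)))

  error-bound : ∀ b T j M → 2 ℕ.≤ b → 1 ℕ.≤ T → T ℕ.≤ M →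
    ∀ n → K-seq b T j ℕ.≤ n → ∣ E b M n ∣ ≤ β-seq T j * ι n
  error-bound b T zero M 2≤b 1≤T T≤M n _ =
    ≤-by refl (*-identityˡ (ι n)) (E-trivial b M n 2≤b (ℕP.≤-trans 1≤T T≤M))
  error-bound b T@(suc T') (suc j) M 2≤b 1≤T T≤M n K≤n with ℕP.m≤n⇒∃[o]m+o≡n T≤n
    where
      T≤n : T ℕ.≤ n
      T≤n = ℕP.≤-trans (ℕP.m≤m*n T T) (ℕP.≤-trans (ℕP.m≤n+m (T ℕ.* T) (T ℕ.^ b ℕ.* K-seq b T j)) K≤n)
  ... | k , refl = ContractionStep.contraction b M T' k (K-seq b T j) (β-seq T j) 2≤b T≤M
        (ℕP.≤-trans (ℕP.m≤n+m (T ℕ.* T) (T ℕ.^ b ℕ.* K-seq b T j)) K≤n)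
        (ℕP.≤-trans (ℕP.m≤m+n (T ℕ.^ b ℕ.* K-seq b T j) (T ℕ.* T)) K≤n)
        (0≤β-seq T j) (error-bound b T j M 2≤b 1≤T T≤M)

  α^ : ℕ → ℚ
  α^ zero    = 1ℚ
  α^ (suc j) = α * α^ j

  β-seq≤ : ∀ T j → β-seq T j ≤ ι 12 * recip T + α^ j
  β-seq≤ T zero    = ≤-by (sym (+-identityˡ 1ℚ)) refl (+-monoˡ-≤ 1ℚ (*-nonNeg (0≤ι 12) (0≤recip T)))
  β-seq≤ T (suc j) = begin
    ι 3 * recip T + α * β-seq T j                     ≤⟨ +-monoʳ-≤ (ι 3 * recip T) (*-monoˡ 0≤α (β-seq≤ T j)) ⟩
    ι 3 * recip T + α * (ι 12 * recip T + α^ j)     ≡⟨ solve 2 (λ x g → con (ι 3) :* x :+ con α :* (con (ι 12) :* x :+ g)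
                                                            := con (ι 12) :* x :+ con α :* g) refl (recip T) (α^ j) ⟩
    ι 12 * recip T + α * α^ j ∎
    where open ≤-Reasoning

  -- … and α^j ≤ 3/(j + 3), since (3/4) (1/n) ≤ 1/(n + 1) for n ≥ 3.
  α-recip : ∀ n → 3 ℕ.≤ n → α * recip n ≤ recip (suc n)
  α-recip n 3≤n = *-cancelʳ-≤-pos c {{positive-c}} (≤-by eqL eqR (ι-mono 3[n+1]≤4n))
    where
      1≤n : 1 ℕ.≤ n
      1≤n = ℕP.≤-trans (ℕ.s≤s ℕ.z≤n) 3≤n
      c = ι 4 * (ι n * ι (suc n))
      positive-c : Data.Rational.Positive c
      positive-c = pos*pos⇒pos (ι 4) {{Data.Rational.positive (0<ι 4 (ℕ.s≤s ℕ.z≤n))}} (ι n * ι (suc n))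
        {{pos*pos⇒pos (ι n) {{Data.Rational.positive (0<ι n 1≤n)}} (ι (suc n)) {{Data.Rational.positive (0<ι (suc n) (ℕ.s≤s ℕ.z≤n))}}}}
      3[n+1]≤4n : 3 ℕ.* suc n ℕ.≤ 4 ℕ.* n
      3[n+1]≤4n = subst (ℕ._≤ 4 ℕ.* n) (sym (ℕP.*-suc 3 n)) (ℕP.+-monoˡ-≤ (3 ℕ.* n) 3≤n)
      eqL : α * recip n * c ≡ ι (3 ℕ.* suc n)
      eqL = begin
        α * recip n * c                              ≡⟨ solve 5 (λ a x f y z → a :* x :* (f :* (y :* z)) := (a :* f) :* (x :* y) :* z)
                                                           refl α (recip n) (ι 4) (ι n) (ι (suc n)) ⟩
        (α * ι 4) * (recip n * ι n) * ι (suc n)      ≡⟨ cong₂ (λ p q → p * q * ι (suc n)) (fraction-*-denominator 3 4) (recip-inverse n 1≤n) ⟩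
        ι 3 * 1ℚ * ι (suc n)                         ≡⟨ cong (_* ι (suc n)) (*-identityʳ (ι 3)) ⟩
        ι 3 * ι (suc n)                              ≡⟨ sym (ι-* 3 (suc n)) ⟩
        ι (3 ℕ.* suc n) ∎
        where open ≡-Reasoning
      eqR : recip (suc n) * c ≡ ι (4 ℕ.* n)
      eqR = begin
        recip (suc n) * c                            ≡⟨ solve 4 (λ x f y z → x :* (f :* (y :* z)) := f :* y :* (x :* z))
                                                           refl (recip (suc n)) (ι 4) (ι n) (ι (suc n)) ⟩
        ι 4 * ι n * (recip (suc n) * ι (suc n))      ≡⟨ cong (ι 4 * ι n *_) (recip-inverse (suc n) (ℕ.s≤s ℕ.z≤n)) ⟩
        ι 4 * ι n * 1ℚ                               ≡⟨ *-identityʳ _ ⟩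
        ι 4 * ι n                                    ≡⟨ sym (ι-* 4 n) ⟩
        ι (4 ℕ.* n) ∎
        where open ≡-Reasoning

  α^j≤ : ∀ j → α^ j ≤ ι 3 * recip (j ℕ.+ 3)
  α^j≤ zero    = ≤-reflexive (sym (trans (*-comm (ι 3) (recip 3)) (recip-inverse 3 (ℕ.s≤s ℕ.z≤n))))
  α^j≤ (suc j) = begin
    α * α^ j                        ≤⟨ *-monoˡ 0≤α (α^j≤ j) ⟩
    α * (ι 3 * recip (j ℕ.+ 3))      ≡⟨ solve 3 (λ a t x → a :* (t :* x) := t :* (a :* x)) refl α (ι 3) (recip (j ℕ.+ 3)) ⟩
    ι 3 * (α * recip (j ℕ.+ 3))      ≤⟨ *-monoˡ (0≤ι 3) (α-recip (j ℕ.+ 3) (ℕP.m≤n+m 3 j)) ⟩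
    ι 3 * recip (suc j ℕ.+ 3) ∎
    where open ≤-Reasoning

  -- With T = 24 m and j = 6 m iterations: β ≤ 1/(2m) + 1/(2m) = 1/m.
  β-seq-small : ∀ m → 1 ℕ.≤ m → β-seq (24 ℕ.* m) (6 ℕ.* m) ≤ recip m
  β-seq-small m 1≤m = begin
    β-seq (24 ℕ.* m) (6 ℕ.* m)                        ≤⟨ β-seq≤ (24 ℕ.* m) (6 ℕ.* m) ⟩
    ι 12 * recip (24 ℕ.* m) + α^ (6 ℕ.* m)           ≤⟨ +-monoʳ-≤ (ι 12 * recip (24 ℕ.* m))
                                                           (≤-trans (α^j≤ (6 ℕ.* m)) (*-monoˡ (0≤ι 3) (recip-antitone 1≤6m (ℕP.m≤m+n (6 ℕ.* m) 3)))) ⟩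
    ι 12 * recip (24 ℕ.* m) + ι 3 * recip (6 ℕ.* m)   ≡⟨ cong₂ _+_ (scaled 12 (ℕ.s≤s ℕ.z≤n)) (scaled 3 (ℕ.s≤s ℕ.z≤n)) ⟩
    recip (2 ℕ.* m) + recip (2 ℕ.* m)                 ≡⟨ solve 1 (λ x → x :+ x := con (ι 2) :* x) refl (recip (2 ℕ.* m)) ⟩
    ι 2 * recip (2 ℕ.* m)                             ≡⟨ recip-scale 2 m 1≤m (ℕ.s≤s ℕ.z≤n) ⟩
    recip m ∎
    where
      open ≤-Reasoning
      1≤2m : 1 ℕ.≤ 2 ℕ.* m
      1≤2m = ℕP.*-mono-≤ {1} {2} (ℕ.s≤s ℕ.z≤n) 1≤m
      1≤6m : 1 ℕ.≤ 6 ℕ.* m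
      1≤6m = ℕP.*-mono-≤ {1} {6} (ℕ.s≤s ℕ.z≤n) 1≤m
      scaled : ∀ c → 1 ℕ.≤ c → ι c * recip (2 ℕ.* c ℕ.* m) ≡ recip (2 ℕ.* m)
      scaled c 1≤c = trans (cong (λ z → ι c * recip z) (trans (cong (ℕ._* m) (ℕP.*-comm 2 c)) (ℕP.*-assoc c 2 m)))
                           (recip-scale c (2 ℕ.* m) 1≤2m 1≤c)

module Proportion where

  open import Data.Nat as ℕ using (ℕ; zero; suc)
  import Data.Nat.Properties as ℕP
  open import Data.Integer as ℤ using (+_)
  open import Data.Rational as ℚ using (ℚ; 0ℚ; 1ℚ; _+_; _*_; _-_; -_; _/_; _≤_; _<_; ∣_∣; 1/_; mkℚ)
  open import Data.Rational.Properties
  open import Data.Nat.Divisibility using (divides; ∣⇒≤)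
  open import Data.Empty using (⊥-elim)
  open import Data.Product using (Σ; _×_; _,_)
  open import Data.Sum using (inj₁; inj₂)
  open import Data.List using (List; length)
  open import Data.List.Relation.Unary.Unique.Propositional using (Unique)
  open import Relation.Binary.PropositionalEquality
  open import Relation.Nullary using (¬_; yes; no)
  open import Data.Rational.Solver using (module +-*-Solver)
  open +-*-Solver
  open import Defs using (frac; invZetaPartial; zetaPartial; VisibleList)
  open PowerFree using (PowerFree; powerFree?; ≤-^)
  open Counting using (Q; Q-suc; 𝟙-yes; 𝟙-no)
  open VisibleGrid using (visible-count)
  open NaturalEmbedding
  open Rationals
  open ZetaPartial
  open ErrorRecursion

  ProportionWithin : ℕ → ℚ → Set
  ProportionWithin b ε = Σ ℕ λ K → (N M : ℕ) → K ℕ.≤ N → K ℕ.≤ M → (L : List (ℕ × ℕ)) →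
    Unique L → VisibleList b N L → ∣ frac (length L) N - invZetaPartial b M ∣ < ε

  -- Since there are N · Q(N) visible points, it suffices to control N Q(N) / N².
  proportion-from-count : ∀ b ε K →
    (∀ N M → K ℕ.≤ N → K ℕ.≤ M → ∣ frac (N ℕ.* Q b N) N - invZetaPartial b M ∣ < ε) → ProportionWithin b ε
  proportion-from-count b ε K close = K , λ N M K≤N K≤M L L-unique L-visible →
    subst (λ c → ∣ frac c N - invZetaPartial b M ∣ < ε) (sym (visible-count b N L L-unique L-visible)) (close N M K≤N K≤M)

  frac-* : ∀ c n → 1 ℕ.≤ n → frac (n ℕ.* c) n ≡ ι c * recip n
  frac-* c n@(suc n') 1≤n = *-cancelʳ-ι (n ℕ.* n) (ℕP.*-mono-≤ 1≤n 1≤n) (begin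
    frac (n ℕ.* c) n * ι (n ℕ.* n)           ≡⟨ fraction-*-denominator (n ℕ.* c) (n ℕ.* n) ⟩
    ι (n ℕ.* c)                              ≡⟨ ι-* n c ⟩
    ι n * ι c                                ≡⟨ sym (*-identityʳ _) ⟩
    ι n * ι c * 1ℚ                           ≡⟨ cong (ι n * ι c *_) (sym (recip-inverse n 1≤n)) ⟩
    ι n * ι c * (recip n * ι n)              ≡⟨ solve 3 (λ a b x → a :* b :* (x :* a) := b :* x :* (a :* a)) refl (ι n) (ι c) (recip n) ⟩
    ι c * recip n * (ι n * ι n)              ≡⟨ cong (ι c * recip n *_) (sym (ι-* n n)) ⟩
    ι c * recip n * ι (n ℕ.* n) ∎)
    where open ≡-Reasoning

  1≰0 : ¬ (1ℚ ≤ 0ℚ)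
  1≰0 (ℚ.*≤* (ℤ.+≤+ ()))

  invZeta-inverse : ∀ b {M} → 1 ℕ.≤ M → invZetaPartial b M * ζ b M ≡ 1ℚ
  invZeta-inverse b {M} 1≤M with zetaPartial b M ≟ 0ℚ
  ... | yes ζ≡0 = ⊥-elim (1≰0 (subst (1ℚ ≤_) (trans (sym (ζ≡zetaPartial b M)) ζ≡0) (1≤ζ b 1≤M)))
  ... | no  ζ≢0 = trans (cong (1/ zetaPartial b M *_) (sym (ζ≡zetaPartial b M))) (*-inverseˡ (zetaPartial b M))
    where instance _ = ℚ.≢-nonZero ζ≢0

  0≤invZeta : ∀ b {M} → 1 ℕ.≤ M → 0ℚ ≤ invZetaPartial b M
  0≤invZeta b {M} 1≤M with ≤-total 0ℚ (invZetaPartial b M)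
  ... | inj₁ 0≤w = 0≤w
  ... | inj₂ w≤0 = ⊥-elim (1≰0 (≤-by (sym (invZeta-inverse b 1≤M)) (sym (*-zeroˡ (ζ b M)))
                                     (*-monoʳ (≤-trans 0≤1 (1≤ζ b 1≤M)) w≤0)))

  invZeta≤1 : ∀ b {M} → 1 ℕ.≤ M → invZetaPartial b M ≤ 1ℚ
  invZeta≤1 b {M} 1≤M = ≤-by (sym (*-identityʳ _)) (sym (invZeta-inverse b 1≤M)) (*-monoˡ (0≤invZeta b 1≤M) (1≤ζ b 1≤M))

  -- The distance of the proportion N Q(N) / N² from 1/ζ_M is |E_M(N)| / (N ζ_M) ≤ |E_M(N)| / N.
  proportion-error : ∀ b M N β → 1 ℕ.≤ M → 1 ℕ.≤ N → 0ℚ ≤ β → ∣ E b M N ∣ ≤ β * ι N →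
    ∣ frac (N ℕ.* Q b N) N - invZetaPartial b M ∣ ≤ β
  proportion-error b M N β 1≤M 1≤N 0≤β |E|≤βN = begin
    ∣ frac (N ℕ.* Q b N) N - w ∣  ≡⟨ cong ∣_∣ difference ⟩
    ∣ E b M N * (x * w) ∣         ≡⟨ ∣p*q∣≡∣p∣*∣q∣ (E b M N) (x * w) ⟩
    ∣ E b M N ∣ * ∣ x * w ∣       ≡⟨ cong (∣ E b M N ∣ *_) (0≤p⇒∣p∣≡p 0≤w/N) ⟩
    ∣ E b M N ∣ * (x * w)         ≤⟨ *-monoʳ 0≤w/N |E|≤βN ⟩
    β * ι N * (x * w)             ≡⟨ solve 4 (λ β n x w → β :* n :* (x :* w) := β :* w :* (x :* n)) refl β (ι N) x w ⟩
    β * w * (x * ι N)             ≡⟨ cong (β * w *_) (recip-inverse N 1≤N) ⟩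
    β * w * 1ℚ                    ≡⟨ *-identityʳ (β * w) ⟩
    β * w                         ≤⟨ *-monoˡ 0≤β (invZeta≤1 b 1≤M) ⟩
    β * 1ℚ                        ≡⟨ *-identityʳ β ⟩
    β                             ∎
    where
      open ≤-Reasoning
      w = invZetaPartial b M
      q = ι (Q b N)
      x = recip N
      0≤w/N : 0ℚ ≤ x * w
      0≤w/N = *-nonNeg (0≤recip N) (0≤invZeta b 1≤M)
      -- With q = Q(N) and x = 1/N:  q x − w = (ζ_M q − N) (x w), as w ζ_M = 1 = x N.
      difference : frac (N ℕ.* Q b N) N - w ≡ E b M N * (x * w)
      difference = begin-equality
        frac (N ℕ.* Q b N) N - w           ≡⟨ cong (_- w) (frac-* (Q b N) N 1≤N) ⟩
        q * x - w                          ≡⟨ solve 3 (λ q x w → q :* x :- w := q :* x :* con 1ℚ :- con 1ℚ :* w) refl q x w ⟩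
        q * x * 1ℚ - 1ℚ * w                ≡⟨ cong₂ (λ u v → q * x * u - v * w) (sym (invZeta-inverse b 1≤M)) (sym (recip-inverse N 1≤N)) ⟩
        q * x * (w * ζ b M) - x * ι N * w  ≡⟨ solve 5 (λ q x w z n → q :* x :* (w :* z) :- x :* n :* w := (z :* q :- n) :* (x :* w))
                                                refl q x w (ζ b M) (ι N) ⟩
        E b M N * (x * w)                  ∎

  recip-strict : ∀ n → 1 ℕ.≤ n → recip (suc n) < recip n
  recip-strict n 1≤n = *-cancelʳ-<-nonNeg r {{ℚ.nonNegative (*-nonNeg (0≤ι n) (0≤ι (suc n)))}} (subst₂ _<_ (sym eqL) (sym eqR) n<n+1)
    where
      r = ι n * ι (suc n)
      eqL : recip (suc n) * r ≡ ι n
      eqL = trans (solve 3 (λ x a b → x :* (a :* b) := a :* (x :* b)) refl (recip (suc n)) (ι n) (ι (suc n)))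
              (trans (cong (ι n *_) (recip-inverse (suc n) (ℕ.s≤s ℕ.z≤n))) (*-identityʳ (ι n)))
      eqR : recip n * r ≡ ι (suc n)
      eqR = trans (sym (*-assoc (recip n) (ι n) (ι (suc n))))
              (trans (cong (_* ι (suc n)) (recip-inverse n 1≤n)) (*-identityˡ (ι (suc n))))
      n<n+1 : ι n < ι (suc n)
      n<n+1 = subst (_< ι (suc n)) (+-identityˡ (ι n)) (+-monoˡ-< (ι n) 0<1)

  -- Archimedes: every positive rational ε = (p+1)/(q+1) exceeds 1/(q+2).
  recip-below : ∀ ε → 0ℚ < ε → Σ ℕ λ m → 1 ℕ.≤ m × recip m < ε
  recip-below (mkℚ (+ zero) q _)      (ℚ.*<* (ℤ.+<+ ()))
  recip-below (mkℚ ℤ.-[1+ p ] q _)   (ℚ.*<* ())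
  recip-below ε@(mkℚ (+ suc p) q _) _ = suc (suc q) , ℕ.s≤s ℕ.z≤n , <-≤-trans (recip-strict (suc q) (ℕ.s≤s ℕ.z≤n)) 1/[q+1]≤ε
    where
      1/[q+1]≤ε : recip (suc q) ≤ ε
      1/[q+1]≤ε = *-cancelʳ-≤-pos (ι (suc q)) {{ℚ.positive (0<ι (suc q) (ℕ.s≤s ℕ.z≤n))}}
        (≤-by (recip-inverse (suc q) (ℕ.s≤s ℕ.z≤n)) (trans (cong (_* ι (suc q)) (sym (↥p/↧p≡p ε))) (fraction-*-denominator (suc p) (suc q)))
           (≤-by (sym ι-1) refl (ι-mono {1} {suc p} (ℕ.s≤s ℕ.z≤n))))

  -- The theorem for b ≥ 2: take m with 1/m < ε, T = 24 m, 6 m contraction steps,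
  -- and K so large that the error bound applies.
  proportion-b≥2 : ∀ b → 2 ℕ.≤ b → ∀ ε → 0ℚ < ε → ProportionWithin b ε
  proportion-b≥2 b 2≤b ε 0<ε with recip-below ε 0<ε
  ... | m , 1≤m , 1/m<ε = proportion-from-count b ε K close
    where
      T j K : ℕ
      T = 24 ℕ.* m
      j = 6 ℕ.* m
      K = K-seq b T j ℕ.+ T
      1≤T : 1 ℕ.≤ T
      1≤T = ℕP.*-mono-≤ {1} {24} (ℕ.s≤s ℕ.z≤n) 1≤m
      close : ∀ N M → K ℕ.≤ N → K ℕ.≤ M → ∣ frac (N ℕ.* Q b N) N - invZetaPartial b M ∣ < ε
      close N M K≤N K≤M = ≤-<-trans
        (proportion-error b M N (β-seq T j) (ℕP.≤-trans 1≤T T≤M) (ℕP.≤-trans 1≤T T≤N) (0≤β-seq T j)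
          (error-bound b T j M 2≤b 1≤T T≤M N (ℕP.≤-trans (ℕP.m≤m+n (K-seq b T j) T) K≤N)))
        (≤-<-trans (β-seq-small m 1≤m) 1/m<ε)
        where
          T≤M : T ℕ.≤ M
          T≤M = ℕP.≤-trans (ℕP.m≤n+m T (K-seq b T j)) K≤M
          T≤N : T ℕ.≤ N
          T≤N = ℕP.≤-trans (ℕP.m≤n+m T (K-seq b T j)) K≤N

  distance-in-interval : ∀ {x y c} → 0ℚ ≤ x → x ≤ c → 0ℚ ≤ y → y ≤ c → ∣ x - y ∣ ≤ c
  distance-in-interval {x} {y} {c} 0≤x x≤c 0≤y y≤c = abs-≤
    (≤-by (solve 1 (λ z → :- z := con 0ℚ :+ (:- z)) refl c) refl (+-mono-≤ 0≤x (neg-antimono-≤ y≤c)))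
    (≤-by refl (sym (+-identityʳ c)) (+-mono-≤ x≤c (neg-antimono-≤ 0≤y)))

  -- For b = 1 only s = 1 is 1-power-free, so Q(N) = 1 …
  Q₁≡1 : ∀ n → Q 1 (suc n) ≡ 1
  Q₁≡1 zero    = trans (Q-suc 1 0) (𝟙-yes (powerFree? 1 1) 1-free)
    where
      1-free : PowerFree 1 1
      1-free d 2≤d d∣1 = ℕP.<⇒≱ 2≤d (ℕP.≤-trans (≤-^ d 1 (ℕP.≤-trans (ℕ.s≤s ℕ.z≤n) 2≤d) (ℕ.s≤s ℕ.z≤n)) (∣⇒≤ d∣1))
  Q₁≡1 (suc n) = trans (Q-suc 1 (suc n)) (cong₂ ℕ._+_ (Q₁≡1 n) (𝟙-no (powerFree? 1 (suc (suc n))) not-free))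
    where
      not-free : ¬ PowerFree 1 (suc (suc n))
      not-free free = free (suc (suc n)) (ℕ.s≤s (ℕ.s≤s ℕ.z≤n)) (divides 1 (sym (trans (ℕP.*-identityˡ _) (ℕP.*-identityʳ _))))

  -- … hence the proportion is N / N² = 1/N …
  proportion₁ : ∀ N → 1 ℕ.≤ N → frac (N ℕ.* Q 1 N) N ≡ recip N
  proportion₁ (suc n) 1≤N = trans (cong (λ c → frac (suc n ℕ.* c) (suc n)) (Q₁≡1 n))
    (trans (frac-* 1 (suc n) 1≤N) (trans (cong (_* recip (suc n)) ι-1) (*-identityˡ _)))

  -- … which, like 1/ζ_M(1) = 1/H_M, is at most 1/m for N ≥ m and M ≥ 4^m.
  proportion-b≡1 : ∀ ε → 0ℚ < ε → ProportionWithin 1 ε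
  proportion-b≡1 ε 0<ε with recip-below ε 0<ε
  ... | m , 1≤m , 1/m<ε = proportion-from-count 1 ε K close
    where
      K : ℕ
      K = 2 ℕ.^ (2 ℕ.* m) ℕ.+ m
      close : ∀ N M → K ℕ.≤ N → K ℕ.≤ M → ∣ frac (N ℕ.* Q 1 N) N - invZetaPartial 1 M ∣ < ε
      close N M K≤N K≤M = ≤-<-trans
        (distance-in-interval (≤-by refl (proportion₁ N 1≤N) (0≤recip N)) (≤-by (proportion₁ N 1≤N) refl (recip-antitone 1≤m m≤N))
                              (0≤invZeta 1 1≤M) 1/ζ≤1/m)
        1/m<ε
        where
          m≤N : m ℕ.≤ N
          m≤N = ℕP.≤-trans (ℕP.m≤n+m m _) K≤N
          4^m≤M : 2 ℕ.^ (2 ℕ.* m) ℕ.≤ M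
          4^m≤M = ℕP.≤-trans (ℕP.m≤m+n _ m) K≤M
          1≤N : 1 ℕ.≤ N
          1≤N = ℕP.≤-trans 1≤m m≤N
          1≤M : 1 ℕ.≤ M
          1≤M = ℕP.≤-trans (ℕP.m^n>0 2 (2 ℕ.* m)) 4^m≤M
          1/ζ≤1/m : invZetaPartial 1 M ≤ recip m
          1/ζ≤1/m = inverse-antitone (0≤invZeta 1 1≤M) (0≤recip m) (invZeta-inverse 1 1≤M) (recip-inverse m 1≤m)
                      (≤-trans (harmonic-unbounded m) (ζ-mono 1 4^m≤M))

open import Defs
open import Data.Nat using (ℕ; _≤_)
open import Data.Integer using (+_)
open import Data.Rational using (ℚ; 0ℚ; _<_; _-_; ∣_∣)
open import Data.Product using (Σ; _×_)
open import Data.List using (List; length)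
open import Data.List.Relation.Unary.Unique.Propositional using (Unique)
open import Data.Nat using (zero; suc; s≤s; z≤n)

lemma3 : (b : ℕ) → 1 ≤ b → (ε : ℚ) → 0ℚ < ε →
    Σ ℕ (λ K → (N M : ℕ) → K ≤ N → K ≤ M → (L : List (ℕ × ℕ)) →
    Unique L → VisibleList b N L →
    ∣ frac (length L) N - invZetaPartial b M ∣ < ε)
lemma3 zero          () ε 0<ε
lemma3 (suc zero)    _  ε 0<ε = Proportion.proportion-b≡1 ε 0<ε
lemma3 (suc (suc b)) _  ε 0<ε = Proportion.proportion-b≥2 (suc (suc b)) (s≤s (s≤s z≤n)) ε 0<ε
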